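{- Let $A$ be a set of vertices of the $n$-cycle $C_n$ with $2\leq |A|=m\leq n$. (1) If $n$ is even or $m$ is odd, then $A$ is a maximizer of $W$ on $C_n$ if and only if $A$ is balanced. (2) If $n$ is odd and $m$ is even, then $A$ is a maximizer of $W$ on $C_n$ if and only if $A$ is weakly balanced; moreover, in this case no maximizer of $W$ on $C_n$ of cardinality $m$ is balanced. (3) $A$ is a maximizer of $W$ on $C_n$ if and only if $A$ is weakly balanced.
   Context: $C_n$ has vertices $0,\ldots,n-1$ with $u$ adjacent to $u\pm1\bmod n$; $d$ is the graph distance; $W(X)=\sum_{\{u,v\}\subseteq X,\,u\neq v}d(u,v)$; $A$ is a maximizer of $W$ if $W(A)=\max\{W(B): B\subseteq V(C_n), |B|=|A|\}$. An equitable $2$-partition of $V(C_n)$ with connected blocks is a partition $\{P,Q\}$ of $V(C_n)$ into two sets whose cardinalities differ by at most one and each of which induces a connected subgraph. $A$ is balanced if for every such partition $\{P,Q\}$, $|A\cap P|$ and $|A\cap Q|$ differ by at most one. $A$ is weakly balanced if for every such partition $\{P,Q\}$, $|A\cap P|$ and $|A\cap Q|$ differ by at most two, and whenever $|A\cap Q|=|A\cap P|+2$ we have $|P|<|Q|$. -}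

module Defs where

open import Data.Nat using (ℕ; zero; suc; _+_; _∸_; _≤_; _<_; _<ᵇ_; _⊓_)
open import Data.Bool using (Bool; true; false; _∧_; if_then_else_)
open import Data.Fin using (Fin; toℕ)
open import Data.Fin.Subset using (Subset; _∈_; ∁; _∩_; ∣_∣)
open import Data.Vec using (lookup)
open import Data.List using (List; map; concatMap; allFin)
open import Data.Nat.ListAction using (sum)
open import Data.Product using (_×_)
open import Data.Sum using (_⊎_)
open import Relation.Binary.PropositionalEquality using (_≡_)

∣_-_∣ : ℕ → ℕ → ℕ
∣ a - b ∣ = (a ∸ b) + (b ∸ a)

dist : (n : ℕ) → Fin n → Fin n → ℕ
dist n u v = ∣ toℕ u - toℕ v ∣ ⊓ (n ∸ ∣ toℕ u - toℕ v ∣)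

pairTerm : (n : ℕ) → Subset n → Fin n → Fin n → ℕ
pairTerm n X u v =
  if (lookup X u ∧ lookup X v) ∧ (toℕ u <ᵇ toℕ v) then dist n u v else 0

W : (n : ℕ) → Subset n → ℕ
W n X = sum (concatMap (λ u → map (λ v → pairTerm n X u v) (allFin n)) (allFin n))

Maximizer : (n : ℕ) → Subset n → Set
Maximizer n A = (B : Subset n) → ∣ B ∣ ≡ ∣ A ∣ → W n B ≤ W n A

Adj : (n : ℕ) → Fin n → Fin n → Set
Adj n u v =
  (suc (toℕ u) ≡ toℕ v) ⊎ (suc (toℕ v) ≡ toℕ u)
  ⊎ ((toℕ u ≡ 0) × (suc (toℕ v) ≡ n)) ⊎ ((toℕ v ≡ 0) × (suc (toℕ u) ≡ n))

data Reach (n : ℕ) (P : Subset n) (u : Fin n) : Fin n → Set where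
  here : u ∈ P → Reach n P u u
  step : ∀ {w v} → Reach n P u w → Adj n w v → v ∈ P → Reach n P u v

Connected : (n : ℕ) → Subset n → Set
Connected n P = ∀ u v → u ∈ P → v ∈ P → Reach n P u v

DiffAtMost : ℕ → ℕ → ℕ → Set
DiffAtMost k a b = (a ≤ b + k) × (b ≤ a + k)

-- {P, ∁ P} is an equitable 2-partition of V(C_n) with connected blocks
-- (unordered partitions are covered by letting P range over both blocks)
EquitConnPartition : (n : ℕ) → Subset n → Set
EquitConnPartition n P =
  DiffAtMost 1 ∣ P ∣ ∣ ∁ P ∣ × Connected n P × Connected n (∁ P)

Balanced : (n : ℕ) → Subset n → Set
Balanced n A = (P : Subset n) → EquitConnPartition n P →
  DiffAtMost 1 ∣ A ∩ P ∣ ∣ A ∩ ∁ P ∣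

WeaklyBalanced : (n : ℕ) → Subset n → Set
WeaklyBalanced n A = (P : Subset n) → EquitConnPartition n P →
  DiffAtMost 2 ∣ A ∩ P ∣ ∣ A ∩ ∁ P ∣
  × (∣ A ∩ ∁ P ∣ ≡ ∣ A ∩ P ∣ + 2 → ∣ P ∣ < ∣ ∁ P ∣)

{-# OPTIONS --safe #-}
-- Call the n sets of h = ⌊n/2⌋ consecutive vertices of C_n arcs. Two vertices at distance d are
-- separated (one inside, one outside) by exactly d arcs, so 2 W(A) = Σ_c In(c) Out(c), where
-- In(c) + Out(c) = |A| and Σ_c In(c) = h |A|. As (x - C)(x - C - 1) ≥ 0 on the integers, this sum
-- is bounded by a quantity depending only on |A|, with equality iff every arc holds C or C + 1
-- points of A. For C = ⌊h |A| / n⌋ the bound is attained by the evenly spaced set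
-- {x : ⌊x |A| / n⌋ < ⌊(x + 1) |A| / n⌋}, so maximizers are exactly the sets meeting every arc in
-- C or C + 1 points. The blocks of an equitable partition into connected sets are an arc and its
-- complement, so (weak) balance is also a condition on the pairs (In(c), Out(c)), and the theorem
-- becomes parity arithmetic on these pairs.
module Submission where

open import Data.Bool.Base using (Bool; true; false; not; _∧_; if_then_else_)
open import Data.Empty using (⊥)
open import Data.Fin.Base using (Fin; toℕ; fromℕ<; zero; suc)
open import Data.Fin.Properties using (toℕ-fromℕ<; toℕ-injective; toℕ<n)
open import Data.Fin.Subset using (Subset; _∈_; ∁; _∩_; ∣_∣)
open import Data.Fin.Subset.Properties using (∣∁p∣≡n∸∣p∣; ∣p∣≤n)
open import Data.List.Base as List using (List; map; concat; allFin)
open import Data.List.Properties using (map-∘; map-tabulate)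
open import Data.Nat.Base hiding (∣_-_∣)
open import Data.Nat.DivMod
open import Data.Nat.Divisibility using (_∣_; _∣?_; n∣m⇒m%n≡0; m%n≡0⇒n∣m; divides)
open import Data.Nat.ListAction using (sum)
open import Data.Nat.ListAction.Properties using (sum-++)
open import Data.Nat.Properties
open import Algebra.Properties.CommutativeSemigroup +-commutativeSemigroup
  using () renaming (interchange to +-interchange; xy∙z≈xz∙y to +-xy∙z≈xz∙y)
open import Data.Nat.Tactic.RingSolver using (solve-∀)
open import Data.Product.Base using (_×_; _,_; proj₁; proj₂; ∃-syntax; map₂)
open import Data.Sum.Base using (_⊎_; inj₁; inj₂; [_,_]′)
open import Data.Vec.Base using ([]; _∷_; lookup)
open import Data.Vec.Properties using ([]=⇒lookup; lookup⇒[]=)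
open import Function.Bundles using (_⇔_; mk⇔; Equivalence)
open import Function.Properties.Equivalence using () renaming (trans to ⇔-trans; sym to ⇔-sym)
open import Relation.Binary.Definitions using (tri<; tri≈; tri>)
open import Relation.Binary.PropositionalEquality
open import Relation.Nullary.Decidable.Core using (Dec; yes; no)
open import Relation.Nullary.Negation using (¬_; contradiction)

open import Defs

-- Finite sums over initial segments of ℕ

∑ : ℕ → (ℕ → ℕ) → ℕ
∑ zero    f = 0
∑ (suc n) f = f 0 + ∑ n (λ i → f (suc i))

syntax ∑ n (λ i → e) = ∑[ i < n ] e

∑-cong : ∀ n {f g : ℕ → ℕ} → (∀ i → i < n → f i ≡ g i) → ∑ n f ≡ ∑ n g
∑-cong zero    f≗g = refl
∑-cong (suc n) f≗g = cong₂ _+_ (f≗g 0 z<s) (∑-cong n (λ i i<n → f≗g (suc i) (s<s i<n)))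

∑-snoc : ∀ n f → ∑ (suc n) f ≡ ∑ n f + f n
∑-snoc zero    f = +-comm (f 0) 0
∑-snoc (suc n) f = trans (cong (f 0 +_) (∑-snoc n (λ i → f (suc i)))) (sym (+-assoc (f 0) _ _))

∑-distrib-+ : ∀ n f g → ∑[ i < n ] (f i + g i) ≡ ∑ n f + ∑ n g
∑-distrib-+ zero    f g = refl
∑-distrib-+ (suc n) f g =
  trans (cong (f 0 + g 0 +_) (∑-distrib-+ n (λ i → f (suc i)) (λ i → g (suc i))))
        (+-interchange (f 0) (g 0) _ _)

∑-*ˡ : ∀ n c f → ∑[ i < n ] (c * f i) ≡ c * ∑ n f
∑-*ˡ zero    c f = sym (*-zeroʳ c)
∑-*ˡ (suc n) c f =
  trans (cong (c * f 0 +_) (∑-*ˡ n c (λ i → f (suc i)))) (sym (*-distribˡ-+ c (f 0) _))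

∑-*ʳ : ∀ n c f → ∑[ i < n ] (f i * c) ≡ ∑ n f * c
∑-*ʳ n c f = begin
  ∑[ i < n ] (f i * c) ≡⟨ ∑-cong n (λ i _ → *-comm (f i) c) ⟩
  ∑[ i < n ] (c * f i) ≡⟨ ∑-*ˡ n c f ⟩
  c * ∑ n f            ≡⟨ *-comm c _ ⟩
  ∑ n f * c            ∎
  where open ≡-Reasoning

∑-const : ∀ n c → ∑[ i < n ] c ≡ n * c
∑-const zero    c = refl
∑-const (suc n) c = cong (c +_) (∑-const n c)

∑-zero : ∀ n {f : ℕ → ℕ} → (∀ i → i < n → f i ≡ 0) → ∑ n f ≡ 0
∑-zero n f≗0 = trans (∑-cong n f≗0) (trans (∑-const n 0) (*-zeroʳ n))

∑-one : ∀ n {f : ℕ → ℕ} → (∀ i → i < n → f i ≡ 1) → ∑ n f ≡ n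
∑-one n f≗1 = trans (∑-cong n f≗1) (trans (∑-const n 1) (*-identityʳ n))

∑-comm : ∀ n k (f : ℕ → ℕ → ℕ) → ∑[ i < n ] ∑[ j < k ] f i j ≡ ∑[ j < k ] ∑[ i < n ] f i j
∑-comm zero    k f = sym (∑-zero k (λ _ _ → refl))
∑-comm (suc n) k f =
  trans (cong (∑[ j < k ] f 0 j +_) (∑-comm n k (λ i j → f (suc i) j)))
        (sym (∑-distrib-+ k (f 0) (λ j → ∑[ i < n ] f (suc i) j)))

∑-split : ∀ a b f → ∑ (a + b) f ≡ ∑ a f + ∑[ j < b ] f (a + j)
∑-split zero    b f = refl
∑-split (suc a) b f =
  trans (cong (f 0 +_) (∑-split a b (λ i → f (suc i)))) (sym (+-assoc (f 0) _ _))

∑-mono-≤ : ∀ n {f g : ℕ → ℕ} → (∀ i → i < n → f i ≤ g i) → ∑ n f ≤ ∑ n g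
∑-mono-≤ zero    f≤g = z≤n
∑-mono-≤ (suc n) f≤g = +-mono-≤ (f≤g 0 z<s) (∑-mono-≤ n (λ i i<n → f≤g (suc i) (s<s i<n)))

∑-mono-≤-tight : ∀ n {f g : ℕ → ℕ} → (∀ i → i < n → f i ≤ g i) → ∑ n f ≡ ∑ n g →
                 ∀ i → i < n → f i ≡ g i
∑-mono-≤-tight (suc n) {f} {g} f≤g ∑f≡∑g i i<n with m≤n⇒m<n∨m≡n (f≤g 0 z<s)
... | inj₁ f0<g0 =
  contradiction ∑f≡∑g (<⇒≢ (+-mono-<-≤ f0<g0 (∑-mono-≤ n (λ j j<n → f≤g (suc j) (s<s j<n)))))
... | inj₂ f0≡g0 with i | i<n
...   | zero  | _       = f0≡g0
...   | suc i | s<s i<n =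
  ∑-mono-≤-tight n (λ j j<n → f≤g (suc j) (s<s j<n))
    (+-cancelˡ-≡ (f 0) _ _ (trans ∑f≡∑g (cong (_+ _) (sym f0≡g0)))) i i<n

∑-rotate : ∀ n F → (∀ t → F (t + n) ≡ F t) → ∀ c → ∑[ i < n ] F (c + i) ≡ ∑ n F
∑-rotate n F periodic zero    = refl
∑-rotate n F periodic (suc c) =
  trans (+-cancelʳ-≡ (F c) _ _ shift) (∑-rotate n F periodic c)
  where
  open ≡-Reasoning
  shift : ∑[ i < n ] F (suc c + i) + F c ≡ ∑[ i < n ] F (c + i) + F c
  shift = begin
    ∑[ i < n ] F (suc c + i) + F c     ≡⟨ +-comm _ (F c) ⟩
    F c + ∑[ i < n ] F (suc c + i)     ≡⟨ cong₂ _+_ (cong F (sym (+-identityʳ c)))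
                                                    (∑-cong n (λ i _ → cong F (sym (+-suc c i)))) ⟩
    ∑[ i < suc n ] F (c + i)           ≡⟨ ∑-snoc n (λ i → F (c + i)) ⟩
    ∑[ i < n ] F (c + i) + F (c + n)   ≡⟨ cong (∑[ i < n ] F (c + i) +_) (periodic c) ⟩
    ∑[ i < n ] F (c + i) + F c         ∎

∑-telescope : ∀ (φ : ℕ → ℕ) → (∀ x → φ x ≤ φ (suc x)) →
              ∀ t L → ∑[ j < L ] (φ (suc (t + j)) ∸ φ (t + j)) + φ t ≡ φ (t + L)
∑-telescope φ φ-mono t zero    = cong φ (sym (+-identityʳ t))
∑-telescope φ φ-mono t (suc L) = begin
  ∑[ j < suc L ] Δ j + φ t       ≡⟨ cong (_+ φ t) (∑-snoc L Δ) ⟩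
  ∑[ j < L ] Δ j + Δ L + φ t     ≡⟨ +-xy∙z≈xz∙y (∑[ j < L ] Δ j) (Δ L) (φ t) ⟩
  ∑[ j < L ] Δ j + φ t + Δ L     ≡⟨ cong (_+ Δ L) (∑-telescope φ φ-mono t L) ⟩
  φ (t + L) + Δ L                ≡⟨ m+[n∸m]≡n (φ-mono (t + L)) ⟩
  φ (suc (t + L))                ≡⟨ cong φ (sym (+-suc t L)) ⟩
  φ (t + suc L)                  ∎
  where
  open ≡-Reasoning
  Δ : ℕ → ℕ
  Δ j = φ (suc (t + j)) ∸ φ (t + j)

𝟙 : Bool → ℕ
𝟙 true  = 1
𝟙 false = 0

𝟙-∧ : ∀ a b → 𝟙 (a ∧ b) ≡ 𝟙 a * 𝟙 b
𝟙-∧ true  b = sym (+-identityʳ (𝟙 b))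
𝟙-∧ false b = refl

𝟙-split : ∀ a b → 𝟙 a * 𝟙 b + 𝟙 a * 𝟙 (not b) ≡ 𝟙 a
𝟙-split true  true  = refl
𝟙-split true  false = refl
𝟙-split false b     = refl

<⇒<ᵇ≡true : ∀ {i L} → i < L → (i <ᵇ L) ≡ true
<⇒<ᵇ≡true {zero}  {suc L} _         = refl
<⇒<ᵇ≡true {suc i} {suc L} (s<s i<L) = <⇒<ᵇ≡true i<L

≥⇒<ᵇ≡false : ∀ {i L} → L ≤ i → (i <ᵇ L) ≡ false
≥⇒<ᵇ≡false {i}     {zero}  _         = refl
≥⇒<ᵇ≡false {suc i} {suc L} (s≤s L≤i) = ≥⇒<ᵇ≡false L≤i

<ᵇ≡true⇒< : ∀ {i L} → (i <ᵇ L) ≡ true → i < L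
<ᵇ≡true⇒< {i} {L} i<ᵇL with <-≤-connex i L
... | inj₁ i<L = i<L
... | inj₂ L≤i with () ← trans (sym i<ᵇL) (≥⇒<ᵇ≡false L≤i)

<ᵇ≡false⇒≥ : ∀ {i L} → (i <ᵇ L) ≡ false → L ≤ i
<ᵇ≡false⇒≥ {i} {L} i≮ᵇL with <-≤-connex i L
... | inj₂ L≤i = L≤i
... | inj₁ i<L with () ← trans (sym i≮ᵇL) (<⇒<ᵇ≡true i<L)

∑-<ᵇ : ∀ {n L} → L ≤ n → ∀ f → ∑[ t < n ] (𝟙 (t <ᵇ L) * f t) ≡ ∑ L f
∑-<ᵇ {n} {L} L≤n f = begin
  ∑[ t < n ] g t                             ≡⟨ cong (λ k → ∑ k g) (sym (m+[n∸m]≡n L≤n)) ⟩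
  ∑ (L + (n ∸ L)) g                          ≡⟨ ∑-split L (n ∸ L) g ⟩
  ∑ L g + ∑[ j < n ∸ L ] g (L + j)           ≡⟨ cong₂ _+_ below above ⟩
  ∑ L f + 0                                  ≡⟨ +-identityʳ _ ⟩
  ∑ L f                                      ∎
  where
  open ≡-Reasoning
  g : ℕ → ℕ
  g t = 𝟙 (t <ᵇ L) * f t
  below : ∑ L g ≡ ∑ L f
  below = ∑-cong L (λ t t<L → trans (cong (λ b → 𝟙 b * f t) (<⇒<ᵇ≡true t<L)) (+-identityʳ (f t)))
  above : ∑[ j < n ∸ L ] g (L + j) ≡ 0
  above = ∑-zero (n ∸ L) (λ j _ → cong (λ b → 𝟙 b * f (L + j)) (≥⇒<ᵇ≡false (m≤m+n L j)))

∑-count-< : ∀ {n L} → L ≤ n → ∑[ t < n ] 𝟙 (t <ᵇ L) ≡ L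
∑-count-< {n} {L} L≤n = begin
  ∑[ t < n ] 𝟙 (t <ᵇ L)       ≡⟨ ∑-cong n (λ t _ → sym (*-identityʳ (𝟙 (t <ᵇ L)))) ⟩
  ∑[ t < n ] (𝟙 (t <ᵇ L) * 1) ≡⟨ ∑-<ᵇ L≤n (λ _ → 1) ⟩
  ∑[ t < L ] 1                ≡⟨ ∑-one L (λ _ _ → refl) ⟩
  L                           ∎
  where open ≡-Reasoning

-- Subsets of Fin n as predicates on ℕ

-- Indices ≥ n read as outside.
_‼_ : ∀ {n} → Subset n → ℕ → Bool
[]      ‼ _     = false
(b ∷ p) ‼ zero  = b
(b ∷ p) ‼ suc x = p ‼ x

lookup≡‼ : ∀ {n} (p : Subset n) i → lookup p i ≡ p ‼ toℕ i
lookup≡‼ (b ∷ p) zero    = refl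
lookup≡‼ (b ∷ p) (suc i) = lookup≡‼ p i

∈⇒‼≡true : ∀ {n} {p : Subset n} {i} → i ∈ p → p ‼ toℕ i ≡ true
∈⇒‼≡true {p = p} {i} i∈p = trans (sym (lookup≡‼ p i)) ([]=⇒lookup i∈p)

‼≡true⇒∈ : ∀ {n} {p : Subset n} {i} → p ‼ toℕ i ≡ true → i ∈ p
‼≡true⇒∈ {p = p} {i} p‼i = lookup⇒[]= i p (trans (lookup≡‼ p i) p‼i)

‼-∩ : ∀ {n} (p q : Subset n) x → (p ∩ q) ‼ x ≡ (p ‼ x ∧ q ‼ x)
‼-∩ []      []      x       = refl
‼-∩ (a ∷ p) (b ∷ q) zero    = refl
‼-∩ (a ∷ p) (b ∷ q) (suc x) = ‼-∩ p q x

‼-∁ : ∀ {n} (p : Subset n) {x} → x < n → ∁ p ‼ x ≡ not (p ‼ x)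
‼-∁ (a ∷ p) {zero}  _         = refl
‼-∁ (a ∷ p) {suc x} (s<s x<n) = ‼-∁ p x<n

‼-ext : ∀ {n} {p q : Subset n} → (∀ x → x < n → p ‼ x ≡ q ‼ x) → p ≡ q
‼-ext {p = []}    {[]}    _   = refl
‼-ext {p = a ∷ p} {b ∷ q} p≗q =
  cong₂ _∷_ (p≗q 0 z<s) (‼-ext (λ x x<n → p≗q (suc x) (s<s x<n)))

∁-involutive : ∀ {n} (p : Subset n) → ∁ (∁ p) ≡ p
∁-involutive []            = refl
∁-involutive (true ∷ p)  = cong (true ∷_) (∁-involutive p)
∁-involutive (false ∷ p) = cong (false ∷_) (∁-involutive p)

fromPred : ∀ n → (ℕ → Bool) → Subset n
fromPred zero    f = []
fromPred (suc n) f = f 0 ∷ fromPred n (λ x → f (suc x))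

‼-fromPred : ∀ n f {x} → x < n → fromPred n f ‼ x ≡ f x
‼-fromPred (suc n) f {zero}  _         = refl
‼-fromPred (suc n) f {suc x} (s<s x<n) = ‼-fromPred n (λ i → f (suc i)) x<n

∣p∣≡∑ : ∀ {n} (p : Subset n) → ∣ p ∣ ≡ ∑[ x < n ] 𝟙 (p ‼ x)
∣p∣≡∑ []          = refl
∣p∣≡∑ (true ∷ p)  = cong suc (∣p∣≡∑ p)
∣p∣≡∑ (false ∷ p) = ∣p∣≡∑ p

∣p∩q∣≡∑ : ∀ {n} (p q : Subset n) → ∣ p ∩ q ∣ ≡ ∑[ x < n ] (𝟙 (p ‼ x) * 𝟙 (q ‼ x))
∣p∩q∣≡∑ {n} p q =
  trans (∣p∣≡∑ (p ∩ q)) (∑-cong n (λ x _ → trans (cong 𝟙 (‼-∩ p q x)) (𝟙-∧ (p ‼ x) (q ‼ x))))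

∣p∩q∣+∣p∩∁q∣≡∣p∣ : ∀ {n} (p q : Subset n) → ∣ p ∩ q ∣ + ∣ p ∩ ∁ q ∣ ≡ ∣ p ∣
∣p∩q∣+∣p∩∁q∣≡∣p∣ {n} p q = begin
  ∣ p ∩ q ∣ + ∣ p ∩ ∁ q ∣
    ≡⟨ cong₂ _+_ (∣p∩q∣≡∑ p q) (∣p∩q∣≡∑ p (∁ q)) ⟩
  ∑[ x < n ] (𝟙 (p ‼ x) * 𝟙 (q ‼ x)) + ∑[ x < n ] (𝟙 (p ‼ x) * 𝟙 (∁ q ‼ x))
    ≡⟨ sym (∑-distrib-+ n _ _) ⟩
  ∑[ x < n ] (𝟙 (p ‼ x) * 𝟙 (q ‼ x) + 𝟙 (p ‼ x) * 𝟙 (∁ q ‼ x))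
    ≡⟨ ∑-cong n (λ x x<n → trans (cong (λ b → 𝟙 (p ‼ x) * 𝟙 (q ‼ x) + 𝟙 (p ‼ x) * 𝟙 b) (‼-∁ q x<n))
                                  (𝟙-split (p ‼ x) (q ‼ x))) ⟩
  ∑[ x < n ] 𝟙 (p ‼ x)
    ≡⟨ sym (∣p∣≡∑ p) ⟩
  ∣ p ∣ ∎
  where open ≡-Reasoning

∣p∣+∣∁p∣≡n : ∀ {n} (p : Subset n) → ∣ p ∣ + ∣ ∁ p ∣ ≡ n
∣p∣+∣∁p∣≡n p = trans (cong (∣ p ∣ +_) (∣∁p∣≡n∸∣p∣ p)) (m+[n∸m]≡n (∣p∣≤n p))

∀<-⇔ : ∀ {n} {P Q : ℕ → Set} → (∀ c → P c ⇔ Q c) → (∀ c → c < n → P c) ⇔ (∀ c → c < n → Q c)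
∀<-⇔ P⇔Q = mk⇔ (λ P-all c c<n → Equivalence.to (P⇔Q c) (P-all c c<n))
               (λ Q-all c c<n → Equivalence.from (P⇔Q c) (Q-all c c<n))

Near : ℕ → ℕ → Set
Near C x = x ≡ C ⊎ x ≡ suc C

near⇒≥ : ∀ {C x} → Near C x → C ≤ x
near⇒≥ (inj₁ refl) = ≤-refl
near⇒≥ (inj₂ refl) = n≤1+n _

data Gap : ℕ → ℕ → Set where
  ≤-gap : ∀ a d → Gap a (a + d)
  >-gap : ∀ b d → Gap (b + suc d) b

gap : ∀ a b → Gap a b
gap zero    b       = ≤-gap 0 b
gap (suc a) zero    = >-gap 0 a
gap (suc a) (suc b) with gap a b
... | ≤-gap a d = ≤-gap (suc a) d
... | >-gap b d = >-gap (suc b) d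

a+[1+k+d]≰a+k : ∀ a k d → a + suc (k + d) ≰ a + k
a+[1+k+d]≰a+k a k d le = ≤⇒≯ (m≤m+n k d) (+-cancelˡ-≤ a _ _ le)

-- (x - C)(x - C - 1) ≥ 0 over the integers.
near-bound : ∀ x C → (2 * C + 1) * x ≤ x * x + C * (C + 1)
near-bound x C with gap C x
... | ≤-gap C zero    = ≤-reflexive (identity₀ C)
  where
  identity₀ : ∀ C → (2 * C + 1) * (C + 0) ≡ (C + 0) * (C + 0) + C * (C + 1)
  identity₀ = solve-∀
... | ≤-gap C (suc d) = ≤-trans (m≤m+n _ (d * suc d)) (≤-reflexive (identity₁ C d))
  where
  identity₁ : ∀ C d → (2 * C + 1) * (C + suc d) + d * suc d ≡ (C + suc d) * (C + suc d) + C * (C + 1)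
  identity₁ = solve-∀
... | >-gap x d       = ≤-trans (m≤m+n _ (suc d * suc (suc d))) (≤-reflexive (identity₂ x d))
  where
  identity₂ : ∀ x d → (2 * (x + suc d) + 1) * x + suc d * suc (suc d) ≡ x * x + (x + suc d) * (x + suc d + 1)
  identity₂ = solve-∀

near-bound-≡⇔near : ∀ x C → (2 * C + 1) * x ≡ x * x + C * (C + 1) ⇔ Near C x
near-bound-≡⇔near x C = mk⇔ (tight x C) near⇒≡
  where
  tight : ∀ x C → (2 * C + 1) * x ≡ x * x + C * (C + 1) → Near C x
  tight x C eq with gap C x
  ... | ≤-gap C 0 = inj₁ (+-identityʳ C)
  ... | ≤-gap C 1 = inj₂ (+-comm C 1)
  ... | ≤-gap C (suc (suc d)) = contradiction (trans eq (identity C d)) (m≢1+m+n _)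
    where
    identity : ∀ C d → (C + suc (suc d)) * (C + suc (suc d)) + C * (C + 1)
                     ≡ suc ((2 * C + 1) * (C + suc (suc d)) + (d * d + 3 * d + 1))
    identity = solve-∀
  ... | >-gap x d = contradiction (trans eq (identity x d)) (m≢1+m+n _)
    where
    identity : ∀ x d → x * x + (x + suc d) * (x + suc d + 1)
                     ≡ suc ((2 * (x + suc d) + 1) * x + (d * d + 3 * d + 1))
    identity = solve-∀
  near⇒≡ : Near C x → (2 * C + 1) * x ≡ x * x + C * (C + 1)
  near⇒≡ (inj₁ refl) = identity C
    where
    identity : ∀ C → (2 * C + 1) * C ≡ C * C + C * (C + 1)
    identity = solve-∀
  near⇒≡ (inj₂ refl) = identity C
    where
    identity : ∀ C → (2 * C + 1) * suc C ≡ suc C * suc C + C * (C + 1)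
    identity = solve-∀

[m%n+k]%n≡[m+k]%n : ∀ m k n .{{_ : NonZero n}} → (m % n + k) % n ≡ (m + k) % n
[m%n+k]%n≡[m+k]%n m k n = begin
  (m % n + k) % n         ≡⟨ %-distribˡ-+ (m % n) k n ⟩
  (m % n % n + k % n) % n ≡⟨ cong (λ r → (r + k % n) % n) (m%n%n≡m%n m n) ⟩
  (m % n + k % n) % n     ≡⟨ sym (%-distribˡ-+ m k n) ⟩
  (m + k) % n             ∎
  where open ≡-Reasoning

[m+k%n]%n≡[m+k]%n : ∀ m k n .{{_ : NonZero n}} → (m + k % n) % n ≡ (m + k) % n
[m+k%n]%n≡[m+k]%n m k n =
  trans (cong (_% n) (+-comm m (k % n))) (trans ([m%n+k]%n≡[m+k]%n k m n) (cong (_% n) (+-comm k m)))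

[m+kn]/n≡m/n+k : ∀ m k n .{{_ : NonZero n}} → (m + k * n) / n ≡ m / n + k
[m+kn]/n≡m/n+k m k n = trans (+-distrib-/-∣ʳ m (divides k refl)) (cong (m / n +_) (m*n/n≡m k n))

[r+kn]/n≡k : ∀ {r} k {n} .{{_ : NonZero n}} → r < n → (r + k * n) / n ≡ k
[r+kn]/n≡k {r} k {n} r<n = trans ([m+kn]/n≡m/n+k r k n) (cong (_+ k) (m<n⇒m/n≡0 r<n))

/-distribˡ-+-near : ∀ a b d .{{_ : NonZero d}} → Near (a / d + b / d) ((a + b) / d)
/-distribˡ-+-near a b d = near (m<n*o⇒m/o<n {n = 2} remainders<2d)
  where
  open ≡-Reasoning
  remainders<2d : a % d + b % d < 2 * d
  remainders<2d = subst (a % d + b % d <_) (cong (d +_) (sym (+-identityʳ d)))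
                        (+-mono-< (m%n<n a d) (m%n<n b d))
  a+b≡ : a + b ≡ (a % d + b % d) + (a / d + b / d) * d
  a+b≡ = begin
    a + b                                          ≡⟨ cong₂ _+_ (m≡m%n+[m/n]*n a d) (m≡m%n+[m/n]*n b d) ⟩
    (a % d + a / d * d) + (b % d + b / d * d)      ≡⟨ +-interchange (a % d) _ (b % d) _ ⟩
    (a % d + b % d) + (a / d * d + b / d * d)      ≡⟨ cong ((a % d + b % d) +_) (sym (*-distribʳ-+ d (a / d) (b / d))) ⟩
    (a % d + b % d) + (a / d + b / d) * d          ∎
  quotient≡ : (a + b) / d ≡ (a % d + b % d) / d + (a / d + b / d)
  quotient≡ = trans (cong (_/ d) a+b≡) ([m+kn]/n≡m/n+k _ _ d)
  near : (a % d + b % d) / d < 2 → Near (a / d + b / d) ((a + b) / d)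
  near carry<2 with (a % d + b % d) / d | quotient≡
  ... | 0 | eq = inj₁ eq
  ... | 1 | eq = inj₂ eq
  ... | suc (suc _) | _ with s<s (s<s ()) ← carry<2

even⇒≡2*half : ∀ {x} → 2 ∣ x → x ≡ 2 * (x / 2)
even⇒≡2*half {x} 2∣x = begin
  x                 ≡⟨ m≡m%n+[m/n]*n x 2 ⟩
  x % 2 + x / 2 * 2 ≡⟨ cong₂ _+_ (n∣m⇒m%n≡0 x 2 2∣x) (*-comm (x / 2) 2) ⟩
  2 * (x / 2)       ∎
  where open ≡-Reasoning

odd⇒≡1+2*half : ∀ {x} → ¬ 2 ∣ x → x ≡ suc (2 * (x / 2))
odd⇒≡1+2*half {x} 2∤x = begin
  x                 ≡⟨ m≡m%n+[m/n]*n x 2 ⟩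
  x % 2 + x / 2 * 2 ≡⟨ cong₂ _+_ x%2≡1 (*-comm (x / 2) 2) ⟩
  suc (2 * (x / 2)) ∎
  where
  open ≡-Reasoning
  x%2≡1 : x % 2 ≡ 1
  x%2≡1 with x % 2 | m%n<n x 2 | m%n≡0⇒n∣m x 2
  ... | 0           | _            | 0⇒2∣x = contradiction (0⇒2∣x refl) 2∤x
  ... | 1           | _            | _     = refl
  ... | suc (suc _) | s<s (s<s ()) | _

a+[a+1]≡1+2a : ∀ a → a + (a + 1) ≡ suc (2 * a)
a+[a+1]≡1+2a = solve-∀

a+1+a≡1+2a : ∀ a → a + 1 + a ≡ suc (2 * a)
a+1+a≡1+2a = solve-∀

a+[a+2]≡2[1+a] : ∀ a → a + (a + 2) ≡ 2 * suc a
a+[a+2]≡2[1+a] = solve-∀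

a+2+a≡2[1+a] : ∀ a → a + 2 + a ≡ 2 * suc a
a+2+a≡2[1+a] = solve-∀

DiffAtMost-sym : ∀ {k a b} → DiffAtMost k a b → DiffAtMost k b a
DiffAtMost-sym (a≤b+k , b≤a+k) = b≤a+k , a≤b+k

diff≤1⇒≢+2 : ∀ {a b} → DiffAtMost 1 a b → a ≢ b + 2
diff≤1⇒≢+2 {b = b} (a≤b+1 , _) refl = a+[1+k+d]≰a+k b 1 0 a≤b+1

diff≤1⇒diff≤2 : ∀ {a b} → DiffAtMost 1 a b → DiffAtMost 2 a b
diff≤1⇒diff≤2 {a} {b} (a≤b+1 , b≤a+1) =
  ≤-trans a≤b+1 (+-monoʳ-≤ b (n≤1+n 1)) , ≤-trans b≤a+1 (+-monoʳ-≤ a (n≤1+n 1))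

diff≤2⇒diff≤1 : ∀ {a b} → DiffAtMost 2 a b → a ≢ b + 2 → b ≢ a + 2 → DiffAtMost 1 a b
diff≤2⇒diff≤1 {a} {b} (a≤b+2 , b≤a+2) a≢b+2 b≢a+2 with gap a b
... | ≤-gap a 0                   = ≤-trans (m≤m+n a 0) (m≤m+n _ 1) , ≤-trans (≤-reflexive (+-identityʳ a)) (m≤m+n a 1)
... | ≤-gap a 1                   = ≤-trans (m≤m+n a 1) (m≤m+n _ 1) , ≤-refl
... | ≤-gap a 2                   = contradiction refl b≢a+2
... | ≤-gap a (suc (suc (suc d))) = contradiction b≤a+2 (a+[1+k+d]≰a+k a 2 d)
... | >-gap b 0                   = ≤-refl , ≤-trans (m≤m+n b 1) (m≤m+n _ 1)
... | >-gap b 1                   = contradiction refl a≢b+2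
... | >-gap b (suc (suc d))       = contradiction a≤b+2 (a+[1+k+d]≰a+k b 2 d)

odd-sum⇒≢+2 : ∀ {a b q} → a + b ≡ suc (2 * q) → a ≢ b + 2
odd-sum⇒≢+2 {b = b} {q} a+b≡1+2q refl = even≢odd (suc b) q (trans (sym (a+2+a≡2[1+a] b)) a+b≡1+2q)

diff≤1⇔≡half : ∀ {a b q} → a + b ≡ 2 * q → DiffAtMost 1 a b ⇔ a ≡ q
diff≤1⇔≡half {a} {b} {q} a+b≡2q = mk⇔ to from
  where
  to : DiffAtMost 1 a b → a ≡ q
  to (a≤b+1 , b≤a+1) with gap a b
  ... | ≤-gap a 0             = *-cancelˡ-≡ a q 2 a+b≡2q
  ... | ≤-gap a 1             = contradiction (trans (sym a+b≡2q) (a+[a+1]≡1+2a a)) (even≢odd q a)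
  ... | ≤-gap a (suc (suc d)) = contradiction b≤a+1 (a+[1+k+d]≰a+k a 1 d)
  ... | >-gap b 0             = contradiction (trans (sym a+b≡2q) (a+1+a≡1+2a b)) (even≢odd q b)
  ... | >-gap b (suc d)       = contradiction a≤b+1 (a+[1+k+d]≰a+k b 1 d)
  from : a ≡ q → DiffAtMost 1 a b
  from refl with refl ← +-cancelˡ-≡ a b (a + 0) a+b≡2q =
    ≤-trans (m≤m+n a 0) (m≤m+n _ 1) , ≤-trans (≤-reflexive (+-identityʳ a)) (m≤m+n a 1)

diff≤1⇔near-half : ∀ {a b q} → a + b ≡ suc (2 * q) → DiffAtMost 1 a b ⇔ Near q a
diff≤1⇔near-half {a} {b} {q} a+b≡1+2q = mk⇔ to from
  where
  to : DiffAtMost 1 a b → Near q a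
  to (a≤b+1 , b≤a+1) with gap a b
  ... | ≤-gap a 0             = contradiction a+b≡1+2q (even≢odd a q)
  ... | ≤-gap a 1             =
    inj₁ (*-cancelˡ-≡ a q 2 (suc-injective (trans (sym (a+[a+1]≡1+2a a)) a+b≡1+2q)))
  ... | ≤-gap a (suc (suc d)) = contradiction b≤a+1 (a+[1+k+d]≰a+k a 1 d)
  ... | >-gap b 0             =
    inj₂ (trans (+-comm b 1) (cong suc (*-cancelˡ-≡ b q 2 (suc-injective (trans (sym (a+1+a≡1+2a b)) a+b≡1+2q)))))
  ... | >-gap b (suc d)       = contradiction a≤b+1 (a+[1+k+d]≰a+k b 1 d)
  from : Near q a → DiffAtMost 1 a b
  from (inj₁ refl)
    with refl ← +-cancelˡ-≡ a b (suc a) (trans a+b≡1+2q (trans (sym (a+[a+1]≡1+2a a)) (cong (a +_) (+-comm a 1)))) =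
    ≤-trans (n≤1+n a) (m≤m+n _ 1) , ≤-reflexive (+-comm 1 a)
  from (inj₂ refl) with refl ← +-cancelˡ-≡ q b (q + 0) (suc-injective a+b≡1+2q) =
    ≤-trans (≤-reflexive (cong suc (sym (+-identityʳ q)))) (≤-reflexive (+-comm 1 (q + 0))) ,
    ≤-trans (≤-reflexive (+-identityʳ q)) (≤-trans (n≤1+n q) (m≤m+n _ 1))

diff≤2⇔near-pred-half : ∀ {a b q} → a + b ≡ 2 * suc q → (DiffAtMost 2 a b × a ≢ b + 2) ⇔ Near q a
diff≤2⇔near-pred-half {a} {b} {q} a+b≡2[1+q] = mk⇔ to from
  where
  to : DiffAtMost 2 a b × a ≢ b + 2 → Near q a
  to ((a≤b+2 , b≤a+2) , a≢b+2) with gap a b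
  ... | ≤-gap a 0                   = inj₂ (*-cancelˡ-≡ a (suc q) 2 a+b≡2[1+q])
  ... | ≤-gap a 1                   = contradiction (trans (sym a+b≡2[1+q]) (a+[a+1]≡1+2a a)) (even≢odd (suc q) a)
  ... | ≤-gap a 2                   =
    inj₁ (suc-injective (*-cancelˡ-≡ (suc a) (suc q) 2 (trans (sym (a+[a+2]≡2[1+a] a)) a+b≡2[1+q])))
  ... | ≤-gap a (suc (suc (suc d))) = contradiction b≤a+2 (a+[1+k+d]≰a+k a 2 d)
  ... | >-gap b 0                   = contradiction (trans (sym a+b≡2[1+q]) (a+1+a≡1+2a b)) (even≢odd (suc q) b)
  ... | >-gap b 1                   = contradiction refl a≢b+2
  ... | >-gap b (suc (suc d))       = contradiction a≤b+2 (a+[1+k+d]≰a+k b 2 d)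
  ≤⇒≢+2 : ∀ {x y} → x ≤ y → x ≢ y + 2
  ≤⇒≢+2 {y = y} x≤y refl = m+1+n≰m y x≤y
  from : Near q a → DiffAtMost 2 a b × a ≢ b + 2
  from (inj₁ refl) with refl ← +-cancelˡ-≡ a b (a + 2) (trans a+b≡2[1+q] (sym (a+[a+2]≡2[1+a] a))) =
    (≤-trans (m≤m+n a 2) (m≤m+n _ 2) , ≤-refl) , ≤⇒≢+2 (m≤m+n a 2)
  from (inj₂ refl) with refl ← +-cancelˡ-≡ a b (a + 0) a+b≡2[1+q] =
    (≤-trans (m≤m+n a 0) (m≤m+n _ 2) , ≤-trans (≤-reflexive (+-identityʳ a)) (m≤m+n a 2)) , ≤⇒≢+2 (m≤m+n a 0)

≤∧≤suc⇒near : ∀ {a b} → a ≤ b → b ≤ suc a → Near a b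
≤∧≤suc⇒near a≤b b≤1+a with m≤n⇒m<n∨m≡n b≤1+a
... | inj₁ b<1+a = inj₁ (≤-antisym (s≤s⁻¹ b<1+a) a≤b)
... | inj₂ b≡1+a = inj₂ b≡1+a

q*n≤m<[1+q]*n⇒m/n≡q : ∀ {m n q} .{{_ : NonZero n}} → q * n ≤ m → m < suc q * n → m / n ≡ q
q*n≤m<[1+q]*n⇒m/n≡q {m} {n} {q} q*n≤m m<[1+q]*n =
  trans (cong (_/ n) (sym (m∸n+n≡m q*n≤m))) ([r+kn]/n≡k q r<n)
  where
  r<n : m ∸ q * n < n
  r<n = +-cancelʳ-< (q * n) _ _ (subst (_< n + q * n) (sym (m∸n+n≡m q*n≤m)) m<[1+q]*n)

∃‼≡true : ∀ {n} {p : Subset n} → 0 < ∣ p ∣ → ∃[ x ] (x < n × p ‼ x ≡ true)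
∃‼≡true {p = true ∷ p}  _     = 0 , z<s , refl
∃‼≡true {p = false ∷ p} 0<∣p∣ with x , x<n , p‼x ← ∃‼≡true {p = p} 0<∣p∣ = suc x , s<s x<n , p‼x

∃‼≡false : ∀ {n} {p : Subset n} → ∣ p ∣ < n → ∃[ x ] (x < n × p ‼ x ≡ false)
∃‼≡false {p = false ∷ p} _          = 0 , z<s , refl
∃‼≡false {p = true ∷ p}  (s<s ∣p∣<n) with x , x<n , p‼x ← ∃‼≡false {p = p} ∣p∣<n = suc x , s<s x<n , p‼x

false→true-crossing : ∀ (f : ℕ → Bool) j → f 0 ≡ false → f j ≡ true →
                      ∃[ i ] (f i ≡ false × f (suc i) ≡ true)
false→true-crossing f zero    f0 fj with () ← trans (sym f0) fj
false→true-crossing f (suc j) f0 fj with f j in fj′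
... | false = j , fj′ , fj
... | true  = false→true-crossing f j f0 fj′

least-false : ∀ (f : ℕ → Bool) j → f j ≡ false →
              ∃[ e ] (e ≤ j × f e ≡ false × (∀ i → i < e → f i ≡ true))
least-false f j fj with f 0 in f0
... | false = 0 , z≤n , f0 , λ _ ()
... | true with j
...   | zero  with () ← trans (sym f0) fj
...   | suc j with e , e≤j , fe , below ← least-false (λ i → f (suc i)) j fj =
  suc e , s≤s e≤j , fe , λ { zero _ → f0 ; (suc i) (s<s i<e) → below i i<e }

near⇒𝟙<ᵇ≡∸ : ∀ {a b} → Near a b → 𝟙 (a <ᵇ b) ≡ b ∸ a
near⇒𝟙<ᵇ≡∸ {a} (inj₁ refl) = trans (cong 𝟙 (≥⇒<ᵇ≡false (≤-refl {a}))) (sym (n∸n≡0 a))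
near⇒𝟙<ᵇ≡∸ {a} (inj₂ refl) = trans (cong 𝟙 (<⇒<ᵇ≡true (n<1+n a))) (sym (m+n∸n≡m 1 a))

not≡true⇒≡false : ∀ {b} → not b ≡ true → b ≡ false
not≡true⇒≡false {false} _ = refl

-- W as a double sum

cycleDist : ℕ → ℕ → ℕ → ℕ
cycleDist n a b = ∣ a - b ∣ ⊓ (n ∸ ∣ a - b ∣)

module _ {n : ℕ} (X : Subset n) where

  orderedDist : ℕ → ℕ → ℕ
  orderedDist u v = if (X ‼ u ∧ X ‼ v) ∧ (u <ᵇ v) then cycleDist n u v else 0

  pairDist : ℕ → ℕ → ℕ
  pairDist u v = 𝟙 (X ‼ u) * 𝟙 (X ‼ v) * cycleDist n u v

  private
    sum-concat : ∀ (xss : List (List ℕ)) → sum (concat xss) ≡ sum (map sum xss)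
    sum-concat List.[]         = refl
    sum-concat (xs List.∷ xss) = trans (sum-++ xs (concat xss)) (cong (sum xs +_) (sum-concat xss))

    sum-tabulate : ∀ {m} (f : Fin m → ℕ) (g : ℕ → ℕ) → (∀ i → f i ≡ g (toℕ i)) →
                   sum (List.tabulate f) ≡ ∑ m g
    sum-tabulate {zero}  f g f≗g = refl
    sum-tabulate {suc m} f g f≗g =
      cong₂ _+_ (f≗g zero) (sum-tabulate (λ i → f (suc i)) (λ i → g (suc i)) (λ i → f≗g (suc i)))

    sum-allFin : ∀ {m} (f : Fin m → ℕ) (g : ℕ → ℕ) → (∀ i → f i ≡ g (toℕ i)) →
                 sum (map f (allFin m)) ≡ ∑ m g
    sum-allFin f g f≗g = trans (cong sum (map-tabulate (λ i → i) f)) (sum-tabulate f g f≗g)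

  W≡∑∑orderedDist : W n X ≡ ∑[ u < n ] ∑[ v < n ] orderedDist u v
  W≡∑∑orderedDist = begin
    sum (concat (map row (allFin n)))      ≡⟨ sum-concat (map row (allFin n)) ⟩
    sum (map sum (map row (allFin n)))     ≡⟨ cong sum (sym (map-∘ (allFin n))) ⟩
    sum (map (λ u → sum (row u)) (allFin n))
      ≡⟨ sum-allFin _ _ (λ u → sum-allFin _ _ (λ v →
           cong₂ (λ a b → if (a ∧ b) ∧ (toℕ u <ᵇ toℕ v) then dist n u v else 0)
                 (lookup≡‼ X u) (lookup≡‼ X v))) ⟩
    ∑[ u < n ] ∑[ v < n ] orderedDist u v  ∎
    where
    open ≡-Reasoning
    row : Fin n → List ℕ
    row u = map (pairTerm n X u) (allFin n)

  pairDist≡orderedDist+orderedDist : ∀ u v → pairDist u v ≡ orderedDist u v + orderedDist v u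
  pairDist≡orderedDist+orderedDist u v with <-cmp u v
  ... | tri< u<v _ _ rewrite <⇒<ᵇ≡true u<v | ≥⇒<ᵇ≡false (<⇒≤ u<v) = split (X ‼ u) (X ‼ v)
    where
    split : ∀ a b → 𝟙 a * 𝟙 b * cycleDist n u v
                  ≡ (if (a ∧ b) ∧ true then cycleDist n u v else 0) + (if (b ∧ a) ∧ false then cycleDist n v u else 0)
    split true  true  = trans (+-identityʳ _) (sym (+-identityʳ _))
    split true  false = refl
    split false true  = refl
    split false false = refl
  ... | tri≈ _ refl _ rewrite ≥⇒<ᵇ≡false (≤-refl {u}) | n∸n≡0 u with X ‼ u
  ...   | true  = refl
  ...   | false = refl
  pairDist≡orderedDist+orderedDist u v | tri> _ _ v<u rewrite <⇒<ᵇ≡true v<u | ≥⇒<ᵇ≡false (<⇒≤ v<u) =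
    split (X ‼ u) (X ‼ v)
    where
    split : ∀ a b → 𝟙 a * 𝟙 b * cycleDist n u v
                  ≡ (if (a ∧ b) ∧ false then cycleDist n u v else 0) + (if (b ∧ a) ∧ true then cycleDist n v u else 0)
    split true  true  = trans (+-identityʳ _) (cong (λ d → d ⊓ (n ∸ d)) (+-comm (u ∸ v) (v ∸ u)))
    split true  false = refl
    split false true  = refl
    split false false = refl

  2*W≡∑∑pairDist : 2 * W n X ≡ ∑[ u < n ] ∑[ v < n ] pairDist u v
  2*W≡∑∑pairDist = sym (begin
    ∑[ u < n ] ∑[ v < n ] pairDist u v
      ≡⟨ ∑-cong n (λ u _ → ∑-cong n (λ v _ → pairDist≡orderedDist+orderedDist u v)) ⟩
    ∑[ u < n ] ∑[ v < n ] (orderedDist u v + orderedDist v u)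
      ≡⟨ ∑-cong n (λ u _ → ∑-distrib-+ n _ _) ⟩
    ∑[ u < n ] (∑[ v < n ] orderedDist u v + ∑[ v < n ] orderedDist v u)
      ≡⟨ ∑-distrib-+ n _ _ ⟩
    ∑[ u < n ] ∑[ v < n ] orderedDist u v + ∑[ u < n ] ∑[ v < n ] orderedDist v u
      ≡⟨ cong (∑[ u < n ] ∑[ v < n ] orderedDist u v +_) (∑-comm n n (λ u v → orderedDist v u)) ⟩
    ∑[ u < n ] ∑[ v < n ] orderedDist u v + ∑[ v < n ] ∑[ u < n ] orderedDist v u
      ≡⟨ cong₂ _+_ (sym W≡∑∑orderedDist) (sym W≡∑∑orderedDist) ⟩
    W n X + W n X
      ≡⟨ cong (W n X +_) (sym (+-identityʳ _)) ⟩
    2 * W n X ∎)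
    where open ≡-Reasoning

module _ {n : ℕ} where

  Adj-sym : ∀ {u v : Fin n} → Adj n u v → Adj n v u
  Adj-sym (inj₁ e)                 = inj₂ (inj₁ e)
  Adj-sym (inj₂ (inj₁ e))          = inj₁ e
  Adj-sym (inj₂ (inj₂ (inj₁ e)))   = inj₂ (inj₂ (inj₂ e))
  Adj-sym (inj₂ (inj₂ (inj₂ e)))   = inj₂ (inj₂ (inj₁ e))

  Reach-target∈ : ∀ {P : Subset n} {u v} → Reach n P u v → v ∈ P
  Reach-target∈ (here u∈P)    = u∈P
  Reach-target∈ (step _ _ v∈P) = v∈P

  Reach-trans : ∀ {P : Subset n} {u v w} → Reach n P u v → Reach n P v w → Reach n P u w
  Reach-trans u⇝v (here _)            = u⇝v
  Reach-trans u⇝v (step v⇝w adj x∈P) = step (Reach-trans u⇝v v⇝w) adj x∈P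

  Reach-sym : ∀ {P : Subset n} {u v} → Reach n P u v → Reach n P v u
  Reach-sym (here u∈P)            = here u∈P
  Reach-sym (step u⇝w adj v∈P) =
    Reach-trans (step (here v∈P) (Adj-sym adj) (Reach-target∈ u⇝w)) (Reach-sym u⇝w)

-- The cycle C_(k+1) and its arcs

module Cycle (k : ℕ) where

  n : ℕ
  n = suc k

  h : ℕ
  h = n / 2

  2h≤n : 2 * h ≤ n
  2h≤n = subst (_≤ n) (*-comm h 2) (m/n*n≤m n 2)

  n≤1+2h : n ≤ suc (2 * h)
  n≤1+2h = begin
    n             ≡⟨ m≡m%n+[m/n]*n n 2 ⟩
    n % 2 + h * 2 ≤⟨ +-mono-≤ (s≤s⁻¹ (m%n<n n 2)) (≤-reflexive (*-comm h 2)) ⟩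
    suc (2 * h)   ∎
    where open ≤-Reasoning

  h+h≤n : h + h ≤ n
  h+h≤n = ≤-trans (+-monoʳ-≤ h (m≤m+n h 0)) 2h≤n

  h≤n : h ≤ n
  h≤n = ≤-trans (m≤m+n h h) h+h≤n

  h≤n∸h : h ≤ n ∸ h
  h≤n∸h = ≤-trans (≤-reflexive (sym (m+n∸n≡m h h))) (∸-monoˡ-≤ h h+h≤n)

  [m+n]%n : ∀ m → (m + n) % n ≡ m % n
  [m+n]%n m = [m+n]%n≡m%n m n

  inArc : ℕ → ℕ → Bool
  inArc c x = (x + c) % n <ᵇ h

  arc : ℕ → Subset n
  arc c = fromPred n (inArc c)

  exit : ℕ → ℕ
  exit y = 𝟙 (not (y % n <ᵇ h))

  exit-low : ∀ {y} → y < h → exit y ≡ 0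
  exit-low {y} y<h = trans (cong (λ r → 𝟙 (not (r <ᵇ h))) (m<n⇒m%n≡m (<-≤-trans y<h h≤n)))
                           (cong (λ b → 𝟙 (not b)) (<⇒<ᵇ≡true y<h))

  exit-high : ∀ {y} → h ≤ y → y < n → exit y ≡ 1
  exit-high {y} h≤y y<n = trans (cong (λ r → 𝟙 (not (r <ᵇ h))) (m<n⇒m%n≡m y<n))
                                (cong (λ b → 𝟙 (not b)) (≥⇒<ᵇ≡false h≤y))

  exit-periodic : ∀ y → exit (y + n) ≡ exit y
  exit-periodic y = cong (λ r → 𝟙 (not (r <ᵇ h))) ([m+n]%n y)

  exits : ℕ → ℕ
  exits δ = ∑[ t < h ] exit (t + δ)

  exits-short : ∀ {δ} → δ ≤ h → exits δ ≡ δ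
  exits-short {δ} δ≤h = begin
    exits δ                                          ≡⟨ cong (λ l → ∑ l leaves) (sym (m∸n+n≡m δ≤h)) ⟩
    ∑ ((h ∸ δ) + δ) leaves                           ≡⟨ ∑-split (h ∸ δ) δ leaves ⟩
    ∑ (h ∸ δ) leaves + ∑[ j < δ ] leaves (h ∸ δ + j) ≡⟨ cong₂ _+_ stay leave ⟩
    δ                                                ∎
    where
    open ≡-Reasoning
    leaves : ℕ → ℕ
    leaves t = exit (t + δ)
    stay : ∑ (h ∸ δ) leaves ≡ 0
    stay = ∑-zero (h ∸ δ) (λ t t<h∸δ → exit-low (subst (t + δ <_) (m∸n+n≡m δ≤h) (+-monoˡ-< δ t<h∸δ)))
    leave : ∑[ j < δ ] leaves (h ∸ δ + j) ≡ δ
    leave = ∑-one δ (λ j j<δ →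
      trans (cong exit (trans (+-xy∙z≈xz∙y (h ∸ δ) j δ) (cong (_+ j) (m∸n+n≡m δ≤h))))
            (exit-high (m≤m+n h j) (<-≤-trans (+-monoʳ-< h j<δ) (≤-trans (+-monoʳ-≤ h δ≤h) h+h≤n))))

  h<δ⇒n∸δ≤h : ∀ {δ} → h < δ → n ∸ δ ≤ h
  h<δ⇒n∸δ≤h {δ} h<δ = ≤-trans (∸-monoˡ-≤ δ n≤1+2h)
    (≤-trans (∸-monoʳ-≤ (suc (2 * h)) h<δ) (≤-reflexive (trans (cong (_∸ suc h) (1+2h≡h+[1+h] h)) (m+n∸n≡m h (suc h)))))
    where
    1+2h≡h+[1+h] : ∀ h → suc (2 * h) ≡ h + suc h
    1+2h≡h+[1+h] = solve-∀

  exits-long : ∀ {δ} → h < δ → δ < n → exits δ ≡ n ∸ δ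
  exits-long {δ} h<δ δ<n = begin
    exits δ                                    ≡⟨ cong (λ l → ∑ l leaves) (sym (m+[n∸m]≡n r≤h)) ⟩
    ∑ (r + (h ∸ r)) leaves                     ≡⟨ ∑-split r (h ∸ r) leaves ⟩
    ∑ r leaves + ∑[ j < h ∸ r ] leaves (r + j) ≡⟨ cong₂ _+_ leave stay ⟩
    r + 0                                      ≡⟨ +-identityʳ r ⟩
    r                                          ∎
    where
    open ≡-Reasoning
    r = n ∸ δ
    leaves : ℕ → ℕ
    leaves t = exit (t + δ)
    r≤h : r ≤ h
    r≤h = h<δ⇒n∸δ≤h h<δ
    leave : ∑ r leaves ≡ r
    leave = ∑-one r (λ t t<r →
      exit-high (≤-trans (<⇒≤ h<δ) (m≤n+m δ t)) (subst (t + δ <_) (m∸n+n≡m (<⇒≤ δ<n)) (+-monoˡ-< δ t<r)))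
    stay : ∑[ j < h ∸ r ] leaves (r + j) ≡ 0
    stay = ∑-zero (h ∸ r) (λ j j<h∸r →
      trans (cong exit (trans (+-xy∙z≈xz∙y r j δ) (trans (cong (_+ j) (m∸n+n≡m (<⇒≤ δ<n))) (+-comm n j))))
            (trans (exit-periodic j) (exit-low (<-≤-trans j<h∸r (m∸n≤m h r)))))

  exits≡ : ∀ δ → δ < n → exits δ ≡ δ ⊓ (n ∸ δ)
  exits≡ δ δ<n with ≤-<-connex δ h
  ... | inj₁ δ≤h = trans (exits-short δ≤h) (sym (m≤n⇒m⊓n≡m (≤-trans δ≤h (≤-trans h≤n∸h (∸-monoʳ-≤ n δ≤h)))))
  ... | inj₂ h<δ = trans (exits-long h<δ δ<n) (sym (m≥n⇒m⊓n≡n (≤-trans (h<δ⇒n∸δ≤h h<δ) (<⇒≤ h<δ))))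

  separations : ℕ → ℕ → ℕ
  separations u v = ∑[ c < n ] (𝟙 (inArc c u) * 𝟙 (not (inArc c v)))

  separations≡exits : ∀ {u} v → u < n → separations u v ≡ exits ((v + (n ∸ u)) % n)
  separations≡exits {u} v u<n = begin
    separations u v                         ≡⟨ ∑-cong n (λ c _ → cong (λ y → 𝟙 (inArc c u) * 𝟙 (not (y <ᵇ h)))
                                                                     (sym (shift c))) ⟩
    ∑[ c < n ] F (u + c)                    ≡⟨ ∑-rotate n F periodic u ⟩
    ∑ n F                                   ≡⟨ ∑-cong n (λ t t<n → cong (λ r → 𝟙 (r <ᵇ h) * exit (t + δ))
                                                                       (m<n⇒m%n≡m t<n)) ⟩
    ∑[ t < n ] (𝟙 (t <ᵇ h) * exit (t + δ)) ≡⟨ ∑-<ᵇ h≤n (λ t → exit (t + δ)) ⟩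
    exits δ                                 ∎
    where
    open ≡-Reasoning
    δ = (v + (n ∸ u)) % n
    F : ℕ → ℕ
    F t = 𝟙 (t % n <ᵇ h) * exit (t + δ)
    periodic : ∀ t → F (t + n) ≡ F t
    periodic t = cong₂ (λ r e → 𝟙 (r <ᵇ h) * e) ([m+n]%n t)
                   (trans (cong exit (+-xy∙z≈xz∙y t n δ)) (exit-periodic (t + δ)))
    shift : ∀ c → (u + c + δ) % n ≡ (v + c) % n
    shift c = begin
      (u + c + δ) % n                 ≡⟨ [m+k%n]%n≡[m+k]%n (u + c) (v + (n ∸ u)) n ⟩
      (u + c + (v + (n ∸ u))) % n     ≡⟨ cong (_% n) (regroup u c v (n ∸ u)) ⟩
      (v + c + (u + (n ∸ u))) % n     ≡⟨ cong (λ x → (v + c + x) % n) (m+[n∸m]≡n (<⇒≤ u<n)) ⟩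
      (v + c + n) % n                 ≡⟨ [m+n]%n (v + c) ⟩
      (v + c) % n                     ∎
      where
      regroup : ∀ u c v w → u + c + (v + w) ≡ v + c + (u + w)
      regroup = solve-∀

  separations-ascending : ∀ {u d} → u < n → u + d < n → separations u (u + d) ≡ cycleDist n u (u + d)
  separations-ascending {u} {d} u<n u+d<n = begin
    separations u (u + d)           ≡⟨ separations≡exits (u + d) u<n ⟩
    exits ((u + d + (n ∸ u)) % n)   ≡⟨ cong exits δ≡d ⟩
    exits d                         ≡⟨ exits≡ d d<n ⟩
    d ⊓ (n ∸ d)                     ≡⟨ cong (λ x → x ⊓ (n ∸ x)) (sym ∣u-[u+d]∣≡d) ⟩
    cycleDist n u (u + d)           ∎
    where
    open ≡-Reasoning
    d<n : d < n
    d<n = ≤-<-trans (m≤n+m d u) u+d<n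
    regroup : ∀ u d w → u + d + w ≡ d + (u + w)
    regroup = solve-∀
    δ≡d : (u + d + (n ∸ u)) % n ≡ d
    δ≡d = trans (cong (_% n) (trans (regroup u d (n ∸ u)) (cong (d +_) (m+[n∸m]≡n (<⇒≤ u<n)))))
                (trans ([m+n]%n d) (m<n⇒m%n≡m d<n))
    ∣u-[u+d]∣≡d : ∣ u - (u + d) ∣ ≡ d
    ∣u-[u+d]∣≡d = cong₂ _+_ (m≤n⇒m∸n≡0 (m≤m+n u d)) (m+n∸m≡n u d)

  separations-descending : ∀ {v d} → v + suc d < n → separations (v + suc d) v ≡ cycleDist n (v + suc d) v
  separations-descending {v} {d} v+e<n = begin
    separations (v + e) v           ≡⟨ separations≡exits v v+e<n ⟩
    exits ((v + (n ∸ (v + e))) % n) ≡⟨ cong exits δ≡n∸e ⟩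
    exits (n ∸ e)                   ≡⟨ exits≡ (n ∸ e) n∸e<n ⟩
    (n ∸ e) ⊓ (n ∸ (n ∸ e))         ≡⟨ cong ((n ∸ e) ⊓_) (m∸[m∸n]≡n e≤n) ⟩
    (n ∸ e) ⊓ e                     ≡⟨ ⊓-comm (n ∸ e) e ⟩
    e ⊓ (n ∸ e)                     ≡⟨ cong (λ x → x ⊓ (n ∸ x)) (sym ∣[v+e]-v∣≡e) ⟩
    cycleDist n (v + e) v           ∎
    where
    open ≡-Reasoning
    e = suc d
    e≤n : e ≤ n
    e≤n = ≤-trans (m≤n+m e v) (<⇒≤ v+e<n)
    n∸e<n : n ∸ e < n
    n∸e<n = s≤s (m∸n≤m k d)
    v≤n∸e : v ≤ n ∸ e
    v≤n∸e = subst (_≤ n ∸ e) (m+n∸n≡m v e) (∸-monoˡ-≤ e (<⇒≤ v+e<n))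
    δ≡n∸e : (v + (n ∸ (v + e))) % n ≡ n ∸ e
    δ≡n∸e = begin
      (v + (n ∸ (v + e))) % n ≡⟨ cong (λ x → (v + x) % n) (trans (cong (n ∸_) (+-comm v e)) (sym (∸-+-assoc n e v))) ⟩
      (v + (n ∸ e ∸ v)) % n   ≡⟨ cong (_% n) (m+[n∸m]≡n v≤n∸e) ⟩
      (n ∸ e) % n             ≡⟨ m<n⇒m%n≡m n∸e<n ⟩
      n ∸ e                   ∎
    ∣[v+e]-v∣≡e : ∣ (v + e) - v ∣ ≡ e
    ∣[v+e]-v∣≡e = trans (cong₂ _+_ (m+n∸m≡n v e) (m≤n⇒m∸n≡0 (m≤m+n v e))) (+-identityʳ e)

  separations≡cycleDist : ∀ {u v} → u < n → v < n → separations u v ≡ cycleDist n u v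
  separations≡cycleDist {u} {v} u<n v<n with gap u v
  ... | ≤-gap u d = separations-ascending u<n v<n
  ... | >-gap v d = separations-descending u<n

  ∑-window : ∀ c L → L ≤ n → ∑[ i < n ] 𝟙 ((c + i) % n <ᵇ L) ≡ L
  ∑-window c L L≤n = begin
    ∑[ i < n ] 𝟙 ((c + i) % n <ᵇ L) ≡⟨ ∑-rotate n (λ t → 𝟙 (t % n <ᵇ L))
                                                   (λ t → cong (λ r → 𝟙 (r <ᵇ L)) ([m+n]%n t)) c ⟩
    ∑[ t < n ] 𝟙 (t % n <ᵇ L)       ≡⟨ ∑-cong n (λ t t<n → cong (λ r → 𝟙 (r <ᵇ L)) (m<n⇒m%n≡m t<n)) ⟩
    ∑[ t < n ] 𝟙 (t <ᵇ L)           ≡⟨ ∑-count-< L≤n ⟩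
    L                               ∎
    where open ≡-Reasoning

  ∑-arc : ∀ c L → L ≤ n → ∑[ x < n ] 𝟙 ((x + c) % n <ᵇ L) ≡ L
  ∑-arc c L L≤n = trans (∑-cong n (λ x _ → cong (λ y → 𝟙 (y % n <ᵇ L)) (+-comm x c))) (∑-window c L L≤n)

  In : Subset n → ℕ → ℕ
  In A c = ∣ A ∩ arc c ∣

  Out : Subset n → ℕ → ℕ
  Out A c = ∣ A ∩ ∁ (arc c) ∣

  In≡∑ : ∀ A c → In A c ≡ ∑[ x < n ] (𝟙 (A ‼ x) * 𝟙 (inArc c x))
  In≡∑ A c = trans (∣p∩q∣≡∑ A (arc c))
    (∑-cong n (λ x x<n → cong (λ b → 𝟙 (A ‼ x) * 𝟙 b) (‼-fromPred n (inArc c) x<n)))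

  Out≡∑ : ∀ A c → Out A c ≡ ∑[ x < n ] (𝟙 (A ‼ x) * 𝟙 (not (inArc c x)))
  Out≡∑ A c = trans (∣p∩q∣≡∑ A (∁ (arc c)))
    (∑-cong n (λ x x<n → cong (λ b → 𝟙 (A ‼ x) * 𝟙 b)
      (trans (‼-∁ (arc c) x<n) (cong not (‼-fromPred n (inArc c) x<n)))))

  In+Out≡∣A∣ : ∀ A c → In A c + Out A c ≡ ∣ A ∣
  In+Out≡∣A∣ A c = ∣p∩q∣+∣p∩∁q∣≡∣p∣ A (arc c)

  -- Each pair at distance d is separated by exactly d of the n arcs.
  2*W≡∑In*Out : ∀ A → 2 * W n A ≡ ∑[ c < n ] (In A c * Out A c)
  2*W≡∑In*Out A = begin
    2 * W n A
      ≡⟨ 2*W≡∑∑pairDist A ⟩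
    ∑[ u < n ] ∑[ v < n ] pairDist A u v
      ≡⟨ ∑-cong n (λ u u<n → ∑-cong n (λ v v<n → pairDist≡∑ u v u<n v<n)) ⟩
    ∑[ u < n ] ∑[ v < n ] ∑[ c < n ] (inside c u * outside c v)
      ≡⟨ ∑-cong n (λ u _ → ∑-comm n n (λ v c → inside c u * outside c v)) ⟩
    ∑[ u < n ] ∑[ c < n ] ∑[ v < n ] (inside c u * outside c v)
      ≡⟨ ∑-comm n n (λ u c → ∑[ v < n ] (inside c u * outside c v)) ⟩
    ∑[ c < n ] ∑[ u < n ] ∑[ v < n ] (inside c u * outside c v)
      ≡⟨ ∑-cong n (λ c _ → ∑-cong n (λ u _ → ∑-*ˡ n (inside c u) (outside c))) ⟩
    ∑[ c < n ] ∑[ u < n ] (inside c u * ∑ n (outside c))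
      ≡⟨ ∑-cong n (λ c _ → ∑-*ʳ n (∑ n (outside c)) (λ u → inside c u)) ⟩
    ∑[ c < n ] (∑[ u < n ] inside c u * ∑ n (outside c))
      ≡⟨ ∑-cong n (λ c _ → sym (cong₂ _*_ (In≡∑ A c) (Out≡∑ A c))) ⟩
    ∑[ c < n ] (In A c * Out A c) ∎
    where
    open ≡-Reasoning
    inside outside : ℕ → ℕ → ℕ
    inside  c u = 𝟙 (A ‼ u) * 𝟙 (inArc c u)
    outside c v = 𝟙 (A ‼ v) * 𝟙 (not (inArc c v))
    regroup : ∀ a b x y → a * b * (x * y) ≡ (a * x) * (b * y)
    regroup = solve-∀
    pairDist≡∑ : ∀ u v → u < n → v < n → pairDist A u v ≡ ∑[ c < n ] (inside c u * outside c v)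
    pairDist≡∑ u v u<n v<n = begin
      𝟙 (A ‼ u) * 𝟙 (A ‼ v) * cycleDist n u v
        ≡⟨ cong (𝟙 (A ‼ u) * 𝟙 (A ‼ v) *_) (sym (separations≡cycleDist u<n v<n)) ⟩
      𝟙 (A ‼ u) * 𝟙 (A ‼ v) * separations u v
        ≡⟨ sym (∑-*ˡ n (𝟙 (A ‼ u) * 𝟙 (A ‼ v)) (λ c → 𝟙 (inArc c u) * 𝟙 (not (inArc c v)))) ⟩
      ∑[ c < n ] (𝟙 (A ‼ u) * 𝟙 (A ‼ v) * (𝟙 (inArc c u) * 𝟙 (not (inArc c v))))
        ≡⟨ ∑-cong n (λ c _ → regroup (𝟙 (A ‼ u)) (𝟙 (A ‼ v)) (𝟙 (inArc c u)) (𝟙 (not (inArc c v)))) ⟩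
      ∑[ c < n ] (inside c u * outside c v) ∎

  ∑In≡h*∣A∣ : ∀ A → ∑[ c < n ] In A c ≡ h * ∣ A ∣
  ∑In≡h*∣A∣ A = begin
    ∑[ c < n ] In A c
      ≡⟨ ∑-cong n (λ c _ → In≡∑ A c) ⟩
    ∑[ c < n ] ∑[ x < n ] (𝟙 (A ‼ x) * 𝟙 (inArc c x))
      ≡⟨ ∑-comm n n (λ c x → 𝟙 (A ‼ x) * 𝟙 (inArc c x)) ⟩
    ∑[ x < n ] ∑[ c < n ] (𝟙 (A ‼ x) * 𝟙 (inArc c x))
      ≡⟨ ∑-cong n (λ x _ → ∑-*ˡ n (𝟙 (A ‼ x)) (λ c → 𝟙 (inArc c x))) ⟩
    ∑[ x < n ] (𝟙 (A ‼ x) * ∑[ c < n ] 𝟙 (inArc c x))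
      ≡⟨ ∑-cong n (λ x _ → cong (𝟙 (A ‼ x) *_) (∑-window x h h≤n)) ⟩
    ∑[ x < n ] (𝟙 (A ‼ x) * h)
      ≡⟨ ∑-*ʳ n h (λ x → 𝟙 (A ‼ x)) ⟩
    ∑[ x < n ] 𝟙 (A ‼ x) * h
      ≡⟨ cong (_* h) (sym (∣p∣≡∑ A)) ⟩
    ∣ A ∣ * h
      ≡⟨ *-comm ∣ A ∣ h ⟩
    h * ∣ A ∣ ∎
    where open ≡-Reasoning

  module _ (A : Subset n) (C : ℕ) where

    private
      m = ∣ A ∣

      arcTerm arcBound : ℕ → ℕ
      arcTerm  c = In A c * Out A c + (2 * C + 1) * In A c
      arcBound c = m * In A c + C * (C + 1)

      regroup : ∀ x y q → (x + y) * x + q ≡ x * y + (x * x + q)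
      regroup = solve-∀

      arcBound≡ : ∀ c → arcBound c ≡ In A c * Out A c + (In A c * In A c + C * (C + 1))
      arcBound≡ c = trans (cong (λ s → s * In A c + C * (C + 1)) (sym (In+Out≡∣A∣ A c)))
                          (regroup (In A c) (Out A c) (C * (C + 1)))

      arcTerm≤arcBound : ∀ c → arcTerm c ≤ arcBound c
      arcTerm≤arcBound c = subst (arcTerm c ≤_) (sym (arcBound≡ c))
                             (+-monoʳ-≤ (In A c * Out A c) (near-bound (In A c) C))

      arcTerm≡arcBound⇔near : ∀ c → arcTerm c ≡ arcBound c ⇔ Near C (In A c)
      arcTerm≡arcBound⇔near c = mk⇔
        (λ eq → Equivalence.to (near-bound-≡⇔near (In A c) C)
                  (+-cancelˡ-≡ (In A c * Out A c) _ _ (trans eq (arcBound≡ c))))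
        (λ near → trans (cong (In A c * Out A c +_) (Equivalence.from (near-bound-≡⇔near (In A c) C) near))
                        (sym (arcBound≡ c)))

      ∑arcTerm : ∑ n arcTerm ≡ 2 * W n A + (2 * C + 1) * (h * m)
      ∑arcTerm = begin
        ∑ n arcTerm
          ≡⟨ ∑-distrib-+ n (λ c → In A c * Out A c) (λ c → (2 * C + 1) * In A c) ⟩
        ∑[ c < n ] (In A c * Out A c) + ∑[ c < n ] ((2 * C + 1) * In A c)
          ≡⟨ cong₂ _+_ (sym (2*W≡∑In*Out A)) (∑-*ˡ n (2 * C + 1) (In A)) ⟩
        2 * W n A + (2 * C + 1) * ∑ n (In A)
          ≡⟨ cong (λ s → 2 * W n A + (2 * C + 1) * s) (∑In≡h*∣A∣ A) ⟩
        2 * W n A + (2 * C + 1) * (h * m) ∎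
        where open ≡-Reasoning

      ∑arcBound : ∑ n arcBound ≡ m * (h * m) + n * (C * (C + 1))
      ∑arcBound = begin
        ∑ n arcBound                                         ≡⟨ ∑-distrib-+ n (λ c → m * In A c) (λ _ → C * (C + 1)) ⟩
        ∑[ c < n ] (m * In A c) + ∑[ c < n ] (C * (C + 1))   ≡⟨ cong₂ _+_ (∑-*ˡ n m (In A)) (∑-const n _) ⟩
        m * ∑ n (In A) + n * (C * (C + 1))                   ≡⟨ cong (λ s → m * s + n * (C * (C + 1))) (∑In≡h*∣A∣ A) ⟩
        m * (h * m) + n * (C * (C + 1))                      ∎
        where open ≡-Reasoning

    -- Summing (In - C)(In - C - 1) ≥ 0 over all arcs, using In + Out = |A| and ∑ In = h |A|.
    2*W-bound : 2 * W n A + (2 * C + 1) * (h * m) ≤ m * (h * m) + n * (C * (C + 1))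
    2*W-bound = subst₂ _≤_ ∑arcTerm ∑arcBound (∑-mono-≤ n (λ c _ → arcTerm≤arcBound c))

    2*W-bound-≡⇔near : 2 * W n A + (2 * C + 1) * (h * m) ≡ m * (h * m) + n * (C * (C + 1))
                       ⇔ (∀ c → c < n → Near C (In A c))
    2*W-bound-≡⇔near = mk⇔
      (λ eq c c<n → Equivalence.to (arcTerm≡arcBound⇔near c)
                      (∑-mono-≤-tight n (λ c _ → arcTerm≤arcBound c) (trans ∑arcTerm (trans eq (sym ∑arcBound))) c c<n))
      (λ near → trans (sym ∑arcTerm)
                  (trans (∑-cong n (λ c c<n → Equivalence.from (arcTerm≡arcBound⇔near c) (near c c<n))) ∑arcBound))

  maximizer⇔near : ∀ (A B₀ : Subset n) C → ∣ B₀ ∣ ≡ ∣ A ∣ → (∀ c → c < n → Near C (In B₀ c)) →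
                   Maximizer n A ⇔ (∀ c → c < n → Near C (In A c))
  maximizer⇔near A B₀ C ∣B₀∣≡∣A∣ B₀-near = mk⇔ max⇒near near⇒max
    where
    m = ∣ A ∣
    K = (2 * C + 1) * (h * m)
    R = m * (h * m) + n * (C * (C + 1))
    bound : ∀ B → ∣ B ∣ ≡ m → 2 * W n B + K ≤ R
    bound B ∣B∣≡m = subst (λ s → 2 * W n B + (2 * C + 1) * (h * s) ≤ s * (h * s) + n * (C * (C + 1)))
                          ∣B∣≡m (2*W-bound B C)
    attained : ∀ B → ∣ B ∣ ≡ m → (∀ c → c < n → Near C (In B c)) → 2 * W n B + K ≡ R
    attained B ∣B∣≡m B-near =
      subst (λ s → 2 * W n B + (2 * C + 1) * (h * s) ≡ s * (h * s) + n * (C * (C + 1)))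
            ∣B∣≡m (Equivalence.from (2*W-bound-≡⇔near B C) B-near)
    max⇒near : Maximizer n A → ∀ c → c < n → Near C (In A c)
    max⇒near A-max = Equivalence.to (2*W-bound-≡⇔near A C) (≤-antisym (bound A refl) (begin
      R                ≡⟨ sym (attained B₀ ∣B₀∣≡∣A∣ B₀-near) ⟩
      2 * W n B₀ + K   ≤⟨ +-monoˡ-≤ K (*-monoʳ-≤ 2 (A-max B₀ ∣B₀∣≡∣A∣)) ⟩
      2 * W n A + K    ∎))
      where open ≤-Reasoning
    near⇒max : (∀ c → c < n → Near C (In A c)) → Maximizer n A
    near⇒max A-near B ∣B∣≡∣A∣ = *-cancelˡ-≤ 2 (+-cancelʳ-≤ K _ _ (begin
      2 * W n B + K    ≤⟨ bound B ∣B∣≡∣A∣ ⟩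
      R                ≡⟨ sym (attained A refl A-near) ⟩
      2 * W n A + K    ∎))
      where open ≤-Reasoning

  -- An evenly spaced set

  evenlySpaced : ℕ → Subset n
  evenlySpaced m = fromPred n (λ x → x * m / n <ᵇ suc x * m / n)

  module _ {m : ℕ} (m≤n : m ≤ n) where

    private
      φ : ℕ → ℕ
      φ x = x * m / n

      φ-mono : ∀ x → φ x ≤ φ (suc x)
      φ-mono x = /-monoˡ-≤ n (m≤n+m (x * m) m)

      φ-suc≤ : ∀ x → φ (suc x) ≤ suc (φ x)
      φ-suc≤ x = begin
        (m + x * m) / n     ≤⟨ /-monoˡ-≤ n (≤-trans (+-monoˡ-≤ (x * m) m≤n) (≤-reflexive
                                 (trans (+-comm n (x * m)) (cong (x * m +_) (sym (*-identityˡ n)))))) ⟩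
        (x * m + 1 * n) / n ≡⟨ [m+kn]/n≡m/n+k (x * m) 1 n ⟩
        φ x + 1             ≡⟨ +-comm (φ x) 1 ⟩
        suc (φ x)           ∎
        where open ≤-Reasoning

      Δ : ℕ → ℕ
      Δ x = φ (suc x) ∸ φ x

      φ-periodic : ∀ x → φ (x + n) ≡ φ x + m
      φ-periodic x = trans (cong (_/ n) (expand x n m)) ([m+kn]/n≡m/n+k (x * m) m n)
        where
        expand : ∀ x n m → (x + n) * m ≡ x * m + m * n
        expand = solve-∀

      Δ-periodic : ∀ x → Δ (x + n) ≡ Δ x
      Δ-periodic x = begin
        φ (suc x + n) ∸ φ (x + n) ≡⟨ cong₂ _∸_ (φ-periodic (suc x)) (φ-periodic x) ⟩
        (φ (suc x) + m) ∸ (φ x + m) ≡⟨ cong₂ _∸_ (+-comm (φ (suc x)) m) (+-comm (φ x) m) ⟩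
        (m + φ (suc x)) ∸ (m + φ x) ≡⟨ [m+n]∸[m+o]≡n∸o m (φ (suc x)) (φ x) ⟩
        Δ x                         ∎
        where open ≡-Reasoning

      ‼evenlySpaced : ∀ {x} → x < n → 𝟙 (evenlySpaced m ‼ x) ≡ Δ x
      ‼evenlySpaced {x} x<n = trans (cong 𝟙 (‼-fromPred n (λ y → φ y <ᵇ φ (suc y)) x<n))
                                    (near⇒𝟙<ᵇ≡∸ (≤∧≤suc⇒near (φ-mono x) (φ-suc≤ x)))

    ∣evenlySpaced∣≡ : ∣ evenlySpaced m ∣ ≡ m
    ∣evenlySpaced∣≡ = begin
      ∣ evenlySpaced m ∣                  ≡⟨ ∣p∣≡∑ (evenlySpaced m) ⟩
      ∑[ x < n ] 𝟙 (evenlySpaced m ‼ x)   ≡⟨ ∑-cong n (λ x x<n → ‼evenlySpaced x<n) ⟩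
      ∑[ x < n ] Δ x                      ≡⟨ sym (+-identityʳ _) ⟩
      ∑[ x < n ] Δ x + φ 0                ≡⟨ ∑-telescope φ φ-mono 0 n ⟩
      φ n                                 ≡⟨ cong (_/ n) (*-comm n m) ⟩
      m * n / n                           ≡⟨ m*n/n≡m m n ⟩
      m                                   ∎
      where open ≡-Reasoning

    -- An arc of h consecutive vertices picks up φ (t + h) - φ t elements, where t is its first vertex.
    near-In-evenlySpaced : ∀ c → c < n → Near (h * m / n) (In (evenlySpaced m) c)
    near-In-evenlySpaced c c<n = cancel (/-distribˡ-+-near (t * m) (h * m) n)
      where
      open ≡-Reasoning
      t = n ∸ c
      F : ℕ → ℕ
      F x = Δ x * 𝟙 ((x + c) % n <ᵇ h)
      F-periodic : ∀ x → F (x + n) ≡ F x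
      F-periodic x = cong₂ (λ d r → d * 𝟙 (r <ᵇ h)) (Δ-periodic x)
                       (trans (cong (_% n) (+-xy∙z≈xz∙y x n c)) ([m+n]%n (x + c)))
      first-vertex : ∀ j → j < n → (t + j + c) % n ≡ j
      first-vertex j j<n = trans (cong (_% n) (regroup t j c)) (trans (cong (λ s → (j + s) % n) (m∸n+n≡m (<⇒≤ c<n)))
                             (trans ([m+n]%n j) (m<n⇒m%n≡m j<n)))
        where
        regroup : ∀ t j c → t + j + c ≡ j + (t + c)
        regroup = solve-∀
      In+φt≡ : In (evenlySpaced m) c + φ t ≡ (t * m + h * m) / n
      In+φt≡ = begin
        In (evenlySpaced m) c + φ t
          ≡⟨ cong (_+ φ t) (In≡∑ (evenlySpaced m) c) ⟩
        ∑[ x < n ] (𝟙 (evenlySpaced m ‼ x) * 𝟙 (inArc c x)) + φ t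
          ≡⟨ cong (_+ φ t) (∑-cong n (λ x x<n → cong (_* 𝟙 (inArc c x)) (‼evenlySpaced x<n))) ⟩
        ∑ n F + φ t
          ≡⟨ cong (_+ φ t) (sym (∑-rotate n F F-periodic t)) ⟩
        ∑[ j < n ] F (t + j) + φ t
          ≡⟨ cong (_+ φ t) (∑-cong n (λ j j<n → trans (cong (λ r → Δ (t + j) * 𝟙 (r <ᵇ h)) (first-vertex j j<n))
                                                      (*-comm (Δ (t + j)) _))) ⟩
        ∑[ j < n ] (𝟙 (j <ᵇ h) * Δ (t + j)) + φ t
          ≡⟨ cong (_+ φ t) (∑-<ᵇ h≤n (λ j → Δ (t + j))) ⟩
        ∑[ j < h ] Δ (t + j) + φ t
          ≡⟨ ∑-telescope φ φ-mono t h ⟩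
        φ (t + h)
          ≡⟨ cong (_/ n) (*-distribʳ-+ m t h) ⟩
        (t * m + h * m) / n ∎
      cancel : Near (φ t + h * m / n) ((t * m + h * m) / n) → Near (h * m / n) (In (evenlySpaced m) c)
      cancel (inj₁ eq) = inj₁ (+-cancelʳ-≡ (φ t) _ _ (trans In+φt≡ (trans eq (+-comm (φ t) _))))
      cancel (inj₂ eq) = inj₂ (+-cancelʳ-≡ (φ t) _ _ (trans In+φt≡ (trans eq (cong suc (+-comm (φ t) _)))))

  -- Connected sets of vertices are arcs

  _↦_ : Fin n → Fin n → Set
  u ↦ v = (toℕ u + 1) % n ≡ toℕ v

  ↦⇒Adj : ∀ {u v} → u ↦ v → Adj n u v
  ↦⇒Adj {u} {v} u↦v with m≤n⇒m<n∨m≡n (toℕ<n u)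
  ... | inj₁ 1+u<n = inj₁ (trans (sym (m<n⇒m%n≡m 1+u<n)) (trans (cong (_% n) (+-comm 1 (toℕ u))) u↦v))
  ... | inj₂ 1+u≡n = inj₂ (inj₂ (inj₂ (v≡0 , 1+u≡n)))
    where
    v≡0 : toℕ v ≡ 0
    v≡0 = trans (sym u↦v) (trans (cong (_% n) (trans (+-comm (toℕ u) 1) 1+u≡n)) (n%n≡0 n))

  Adj⇒↦⊎↤ : ∀ {u v} → Adj n u v → u ↦ v ⊎ v ↦ u
  Adj⇒↦⊎↤ {u} {v} (inj₁ e) =
    inj₁ (trans (cong (_% n) (+-comm (toℕ u) 1)) (trans (cong (_% n) e) (m<n⇒m%n≡m (toℕ<n v))))
  Adj⇒↦⊎↤ {u} {v} (inj₂ (inj₁ e)) =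
    inj₂ (trans (cong (_% n) (+-comm (toℕ v) 1)) (trans (cong (_% n) e) (m<n⇒m%n≡m (toℕ<n u))))
  Adj⇒↦⊎↤ {u} {v} (inj₂ (inj₂ (inj₁ (u≡0 , 1+v≡n)))) =
    inj₂ (trans (cong (_% n) (trans (+-comm (toℕ v) 1) 1+v≡n)) (trans (n%n≡0 n) (sym u≡0)))
  Adj⇒↦⊎↤ {u} {v} (inj₂ (inj₂ (inj₂ (v≡0 , 1+u≡n)))) =
    inj₁ (trans (cong (_% n) (trans (+-comm (toℕ u) 1) 1+u≡n)) (trans (n%n≡0 n) (sym v≡0)))

  -- Coordinates in which the vertex n ∸ c is 0.
  module Rotation (c : ℕ) (c≤n : c ≤ n) where

    offset : ℕ → ℕ
    offset x = (x + c) % n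

    vertexAt : ℕ → Fin n
    vertexAt j = fromℕ< (m%n<n (j + (n ∸ c)) n)

    private
      shift-back : ∀ a b → a + b ≡ n → ∀ x → ((x + a) % n + b) % n ≡ x % n
      shift-back a b a+b≡n x = begin
        ((x + a) % n + b) % n ≡⟨ [m%n+k]%n≡[m+k]%n (x + a) b n ⟩
        (x + a + b) % n       ≡⟨ cong (_% n) (trans (+-assoc x a b) (cong (x +_) a+b≡n)) ⟩
        (x + n) % n           ≡⟨ [m+n]%n x ⟩
        x % n                 ∎
        where open ≡-Reasoning

    offset-vertexAt : ∀ {j} → j < n → offset (toℕ (vertexAt j)) ≡ j
    offset-vertexAt {j} j<n =
      trans (cong offset (toℕ-fromℕ< (m%n<n (j + (n ∸ c)) n)))
            (trans (shift-back (n ∸ c) c (m∸n+n≡m c≤n) j) (m<n⇒m%n≡m j<n))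

    toℕ-vertexAt-offset : ∀ {x} → x < n → toℕ (vertexAt (offset x)) ≡ x
    toℕ-vertexAt-offset {x} x<n =
      trans (toℕ-fromℕ< (m%n<n (offset x + (n ∸ c)) n))
            (trans (shift-back c (n ∸ c) (m+[n∸m]≡n c≤n) x) (m<n⇒m%n≡m x<n))

    vertexAt-offset : ∀ u → vertexAt (offset (toℕ u)) ≡ u
    vertexAt-offset u = toℕ-injective (toℕ-vertexAt-offset (toℕ<n u))

    offset-↦ : ∀ {u v} → u ↦ v → (offset (toℕ u) + 1) % n ≡ offset (toℕ v)
    offset-↦ {u} {v} u↦v = begin
      ((toℕ u + c) % n + 1) % n ≡⟨ [m%n+k]%n≡[m+k]%n (toℕ u + c) 1 n ⟩
      (toℕ u + c + 1) % n       ≡⟨ cong (_% n) (+-xy∙z≈xz∙y (toℕ u) c 1) ⟩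
      (toℕ u + 1 + c) % n       ≡⟨ sym ([m%n+k]%n≡[m+k]%n (toℕ u + 1) c n) ⟩
      ((toℕ u + 1) % n + c) % n ≡⟨ cong offset u↦v ⟩
      offset (toℕ v)            ∎
      where
      open ≡-Reasoning

    ↦⇒offset-suc : ∀ {u v} → suc (offset (toℕ u)) < n → u ↦ v → suc (offset (toℕ u)) ≡ offset (toℕ v)
    ↦⇒offset-suc {u} 1+ou<n u↦v =
      trans (sym (m<n⇒m%n≡m 1+ou<n)) (trans (cong (_% n) (+-comm 1 (offset (toℕ u)))) (offset-↦ {u} u↦v))

    vertexAt-↦ : ∀ j → vertexAt j ↦ vertexAt (suc j)
    vertexAt-↦ j = begin
      (toℕ (vertexAt j) + 1) % n    ≡⟨ cong (λ x → (x + 1) % n) (toℕ-fromℕ< (m%n<n (j + (n ∸ c)) n)) ⟩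
      ((j + (n ∸ c)) % n + 1) % n   ≡⟨ [m%n+k]%n≡[m+k]%n (j + (n ∸ c)) 1 n ⟩
      (j + (n ∸ c) + 1) % n         ≡⟨ cong (_% n) (+-comm (j + (n ∸ c)) 1) ⟩
      (suc j + (n ∸ c)) % n         ≡⟨ sym (toℕ-fromℕ< (m%n<n (suc j + (n ∸ c)) n)) ⟩
      toℕ (vertexAt (suc j))        ∎
      where open ≡-Reasoning

    interval-connected : ∀ (P : Subset n) lo hi → hi ≤ n →
                         (∀ x → x < n → P ‼ x ≡ true ⇔ (lo ≤ offset x × offset x < hi)) →
                         Connected n P
    interval-connected P lo hi hi≤n P≡interval u v u∈P v∈P =
      Reach-trans (Reach-sym (from-lo u u∈P)) (from-lo v v∈P)
      where
      member : ∀ j → lo ≤ j → j < hi → vertexAt j ∈ P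
      member j lo≤j j<hi = ‼≡true⇒∈ (Equivalence.from (P≡interval _ (toℕ<n (vertexAt j)))
        (subst (λ o → lo ≤ o × o < hi) (sym (offset-vertexAt (<-≤-trans j<hi hi≤n))) (lo≤j , j<hi)))
      walk : ∀ d → lo + d < hi → Reach n P (vertexAt lo) (vertexAt (lo + d))
      walk zero    lo+0<hi = subst (λ j → Reach n P (vertexAt lo) (vertexAt j)) (sym (+-identityʳ lo))
                               (here (member lo ≤-refl (subst (_< hi) (+-identityʳ lo) lo+0<hi)))
      walk (suc d) lo+d+1<hi = subst (λ j → Reach n P (vertexAt lo) (vertexAt j)) (sym (+-suc lo d))
        (step (walk d (<-trans (+-monoʳ-< lo (n<1+n d)) lo+d+1<hi))
              (↦⇒Adj (vertexAt-↦ (lo + d)))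
              (member (suc (lo + d)) (≤-trans (m≤m+n lo d) (n≤1+n _)) (subst (_< hi) (+-suc lo d) lo+d+1<hi)))
      from-lo : ∀ w → w ∈ P → Reach n P (vertexAt lo) w
      from-lo w w∈P with lo≤o , o<hi ← Equivalence.to (P≡interval (toℕ w) (toℕ<n w)) (∈⇒‼≡true w∈P) =
        subst (Reach n P (vertexAt lo)) (trans (cong vertexAt (m+[n∸m]≡n lo≤o)) (vertexAt-offset w))
              (walk (offset (toℕ w) ∸ lo) (subst (_< hi) (sym (m+[n∸m]≡n lo≤o)) o<hi))

    module _ (Q : Subset n) (Q-connected : Connected n Q) where

      private
        g : ℕ → Bool
        g j = Q ‼ toℕ (vertexAt j)

        ∉-at : ∀ {v j} → offset (toℕ v) ≡ j → g j ≡ false → ¬ v ∈ Q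
        ∉-at {v} refl gj v∈Q with () ←
          trans (sym (∈⇒‼≡true v∈Q)) (trans (cong (λ w → Q ‼ toℕ w) (sym (vertexAt-offset v))) gj)

        step-below : ∀ {e w v} → e < n → g e ≡ false → g k ≡ false →
                     offset (toℕ w) < e → w ↦ v ⊎ v ↦ w → v ∈ Q → offset (toℕ v) < e
        step-below {e} {w} {v} e<n ge gk ow<e (inj₁ w↦v) v∈Q with m≤n⇒m<n∨m≡n ow<e
        ... | inj₁ 1+ow<e = subst (_< e) (↦⇒offset-suc {w} (<-trans 1+ow<e e<n) w↦v) 1+ow<e
        ... | inj₂ 1+ow≡e =
          contradiction v∈Q (∉-at (trans (sym (↦⇒offset-suc {w} (subst (_< n) (sym 1+ow≡e) e<n) w↦v)) 1+ow≡e) ge)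
        step-below {e} {w} {v} e<n ge gk ow<e (inj₂ v↦w) v∈Q with m≤n⇒m<n∨m≡n (m%n<n (toℕ v + c) n)
        ... | inj₁ 1+ov<n = <-trans (n<1+n _) (subst (_< e) (sym (↦⇒offset-suc {v} 1+ov<n v↦w)) ow<e)
        ... | inj₂ 1+ov≡n = contradiction v∈Q (∉-at (suc-injective 1+ov≡n) gk)

        -- Walks inside Q from offset 0 can neither pass the first gap e nor wrap around through offset k.
        reach-below : ∀ {e} → 0 < e → e < n → g e ≡ false → g k ≡ false →
                      ∀ {v} → Reach n Q (vertexAt 0) v → offset (toℕ v) < e
        reach-below {e} 0<e e<n ge gk (here _)           = subst (_< e) (sym (offset-vertexAt z<s)) 0<e
        reach-below 0<e e<n ge gk (step w-reach adj v∈Q) =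
          step-below e<n ge gk (reach-below 0<e e<n ge gk w-reach) (Adj⇒↦⊎↤ adj) v∈Q

      connected⇒segment : g 0 ≡ true → g k ≡ false → ∀ x → x < n → Q ‼ x ≡ (offset x <ᵇ ∣ Q ∣)
      connected⇒segment g0 gk = segment (least-false g k gk)
        where
        segment : ∃[ e ] (e ≤ k × g e ≡ false × (∀ i → i < e → g i ≡ true)) →
                  ∀ x → x < n → Q ‼ x ≡ (offset x <ᵇ ∣ Q ∣)
        segment (e , e≤k , ge , below) x x<n = trans (pointwise x x<n) (cong (offset x <ᵇ_) (sym ∣Q∣≡e))
          where
          e<n : e < n
          e<n = s≤s e≤k
          0<e : 0 < e
          0<e = n≢0⇒n>0 (λ { refl → contradiction (trans (sym g0) ge) λ () })
          pointwise : ∀ x → x < n → Q ‼ x ≡ (offset x <ᵇ e)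
          pointwise x x<n with <-≤-connex (offset x) e
          ... | inj₁ ox<e = trans (cong (Q ‼_) (sym (toℕ-vertexAt-offset x<n)))
                                  (trans (below (offset x) ox<e) (sym (<⇒<ᵇ≡true ox<e)))
          ... | inj₂ e≤ox with Q ‼ x in Q‼x
          ...   | false = sym (≥⇒<ᵇ≡false e≤ox)
          ...   | true  = contradiction (subst (λ y → offset y < e) (toℕ-fromℕ< x<n)
                                         (reach-below 0<e e<n ge gk (Q-connected _ _ base∈Q x∈Q))) (≤⇒≯ e≤ox)
            where
            base∈Q : vertexAt 0 ∈ Q
            base∈Q = ‼≡true⇒∈ g0
            x∈Q : fromℕ< x<n ∈ Q
            x∈Q = ‼≡true⇒∈ (trans (cong (Q ‼_) (toℕ-fromℕ< x<n)) Q‼x)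
          ∣Q∣≡e : ∣ Q ∣ ≡ e
          ∣Q∣≡e = trans (∣p∣≡∑ Q) (trans (∑-cong n (λ y y<n → cong 𝟙 (pointwise y y<n))) (∑-arc c e (<⇒≤ e<n)))

  -- (s + k) % n is the predecessor of s.
  ∃-entry : ∀ (Q : Subset n) → 0 < ∣ Q ∣ → ∣ Q ∣ < n →
            ∃[ s ] (s < n × Q ‼ s ≡ true × Q ‼ ((s + k) % n) ≡ false)
  ∃-entry Q 0<∣Q∣ ∣Q∣<n
    with r , r<n , Q‼r ← ∃‼≡false {p = Q} ∣Q∣<n | q , q<n , Q‼q ← ∃‼≡true {p = Q} 0<∣Q∣
    = entry (false→true-crossing f (q + (n ∸ r)) f0 fq)
    where
    f : ℕ → Bool
    f j = Q ‼ ((r + j) % n)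
    f0 : f 0 ≡ false
    f0 = trans (cong (λ y → Q ‼ (y % n)) (+-identityʳ r)) (trans (cong (Q ‼_) (m<n⇒m%n≡m r<n)) Q‼r)
    regroup : ∀ r q t → r + (q + t) ≡ q + (r + t)
    regroup = solve-∀
    fq : f (q + (n ∸ r)) ≡ true
    fq = trans (cong (λ y → Q ‼ (y % n)) (trans (regroup r q (n ∸ r)) (cong (q +_) (m+[n∸m]≡n (<⇒≤ r<n)))))
               (trans (cong (Q ‼_) (trans ([m+n]%n q) (m<n⇒m%n≡m q<n))) Q‼q)
    entry : ∃[ i ] (f i ≡ false × f (suc i) ≡ true) → ∃[ s ] (s < n × Q ‼ s ≡ true × Q ‼ ((s + k) % n) ≡ false)
    entry (i , fi , f[1+i]) = (r + suc i) % n , m%n<n (r + suc i) n , f[1+i] , trans (cong (Q ‼_) pred≡) fi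
      where
      wrap : ∀ r i k → r + suc i + k ≡ r + i + suc k
      wrap = solve-∀
      pred≡ : ((r + suc i) % n + k) % n ≡ (r + i) % n
      pred≡ = trans ([m%n+k]%n≡[m+k]%n (r + suc i) k n) (trans (cong (_% n) (wrap r i k)) ([m+n]%n (r + i)))

  connected⇒arc : ∀ (Q : Subset n) → Connected n Q → 0 < ∣ Q ∣ → ∣ Q ∣ < n →
                  ∃[ c ] (c < n × ∀ x → x < n → Q ‼ x ≡ ((x + c) % n <ᵇ ∣ Q ∣))
  connected⇒arc Q Q-connected 0<∣Q∣ ∣Q∣<n with s , s<n , Q‼s , Q‼s-1 ← ∃-entry Q 0<∣Q∣ ∣Q∣<n =
    (n ∸ s) % n , m%n<n (n ∸ s) n ,
    λ x x<n → trans (connected⇒segment Q Q-connected base∈Q pred∉Q x x<n)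
                    (cong (_<ᵇ ∣ Q ∣) (sym ([m+k%n]%n≡[m+k]%n x (n ∸ s) n)))
    where
    open Rotation (n ∸ s) (m∸n≤m n s)
    toℕ-vertexAt : ∀ j → toℕ (vertexAt j) ≡ (j + s) % n
    toℕ-vertexAt j = trans (toℕ-fromℕ< (m%n<n (j + (n ∸ (n ∸ s))) n))
                           (cong (λ t → (j + t) % n) (m∸[m∸n]≡n (<⇒≤ s<n)))
    base∈Q : Q ‼ toℕ (vertexAt 0) ≡ true
    base∈Q = trans (cong (Q ‼_) (trans (toℕ-vertexAt 0) (m<n⇒m%n≡m s<n))) Q‼s
    pred∉Q : Q ‼ toℕ (vertexAt k) ≡ false
    pred∉Q = trans (cong (Q ‼_) (trans (toℕ-vertexAt k) (cong (_% n) (+-comm k s)))) Q‼s-1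

  -- Equitable partitions into connected blocks

  ∣arc∣≡h : ∀ c → ∣ arc c ∣ ≡ h
  ∣arc∣≡h c = trans (∣p∣≡∑ (arc c))
    (trans (∑-cong n (λ x x<n → cong 𝟙 (‼-fromPred n (inArc c) x<n))) (∑-arc c h h≤n))

  ∣∁arc∣≡n∸h : ∀ c → ∣ ∁ (arc c) ∣ ≡ n ∸ h
  ∣∁arc∣≡n∸h c = trans (∣∁p∣≡n∸∣p∣ (arc c)) (cong (n ∸_) (∣arc∣≡h c))

  arc-connected : ∀ c → c < n → Connected n (arc c)
  arc-connected c c<n = interval-connected (arc c) 0 h h≤n (λ x x<n → mk⇔
    (λ inside → z≤n , <ᵇ≡true⇒< (trans (sym (‼-fromPred n (inArc c) x<n)) inside))
    (λ (_ , o<h) → trans (‼-fromPred n (inArc c) x<n) (<⇒<ᵇ≡true o<h)))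
    where open Rotation c (<⇒≤ c<n)

  ∁arc-connected : ∀ c → c < n → Connected n (∁ (arc c))
  ∁arc-connected c c<n = interval-connected (∁ (arc c)) h n ≤-refl (λ x x<n → mk⇔
    (λ outside → <ᵇ≡false⇒≥ (not≡true⇒≡false (trans (sym (‼∁arc x<n)) outside)) , m%n<n (x + c) n)
    (λ (h≤o , _) → trans (‼∁arc x<n) (cong not (≥⇒<ᵇ≡false h≤o))))
    where
    open Rotation c (<⇒≤ c<n)
    ‼∁arc : ∀ {x} → x < n → ∁ (arc c) ‼ x ≡ not (inArc c x)
    ‼∁arc x<n = trans (‼-∁ (arc c) x<n) (cong not (‼-fromPred n (inArc c) x<n))

  diff≤1-h-n∸h : DiffAtMost 1 h (n ∸ h)
  diff≤1-h-n∸h = ≤-trans h≤n∸h (m≤m+n (n ∸ h) 1) ,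
             ≤-trans (∸-monoˡ-≤ h (≤-trans n≤1+2h (≤-reflexive (1+2h≡h+1+h h)))) (≤-reflexive (m+n∸n≡m (h + 1) h))
    where
    1+2h≡h+1+h : ∀ h → suc (2 * h) ≡ h + 1 + h
    1+2h≡h+1+h = solve-∀

  arc-equitable : ∀ c → c < n → EquitConnPartition n (arc c)
  arc-equitable c c<n =
    subst₂ (DiffAtMost 1) (sym (∣arc∣≡h c)) (sym (∣∁arc∣≡n∸h c)) diff≤1-h-n∸h ,
    arc-connected c c<n , ∁arc-connected c c<n

  ∁arc-equitable : ∀ c → c < n → EquitConnPartition n (∁ (arc c))
  ∁arc-equitable c c<n =
    subst (λ Q → DiffAtMost 1 ∣ ∁ (arc c) ∣ ∣ Q ∣ × Connected n (∁ (arc c)) × Connected n Q)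
          (sym (∁-involutive (arc c)))
          (DiffAtMost-sym (proj₁ (arc-equitable c c<n)) , ∁arc-connected c c<n , arc-connected c c<n)

  half-unique : ∀ {a} → 2 * a ≤ n → n ≤ suc (2 * a) → a ≡ h
  half-unique {a} 2a≤n n≤1+2a =
    sym (q*n≤m<[1+q]*n⇒m/n≡q (subst (_≤ n) (*-comm 2 a) 2a≤n)
                             (≤-trans (s≤s n≤1+2a) (≤-reflexive (cong (2 +_) (*-comm 2 a)))))

  -- Weak balance of the partition {arc c, ∁ (arc c)}, read from both blocks;
  -- h < n ∸ h stands for ∣ arc c ∣ < ∣ ∁ (arc c) ∣.
  WeakPair : ℕ → ℕ → Set
  WeakPair a b = DiffAtMost 2 a b × (b ≡ a + 2 → h < n ∸ h) × a ≢ b + 2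

  module _ (0<h : 0 < h) where

    h<n : h < n
    h<n = <-≤-trans (m<m+n h 0<h) h+h≤n

    block-is-arc : ∀ Q → Connected n Q → ∣ Q ∣ ≡ h → ∃[ c ] (c < n × Q ≡ arc c)
    block-is-arc Q Q-connected ∣Q∣≡h =
      as-arc (connected⇒arc Q Q-connected (subst (0 <_) (sym ∣Q∣≡h) 0<h) (subst (_< n) (sym ∣Q∣≡h) h<n))
      where
      as-arc : ∃[ c ] (c < n × ∀ x → x < n → Q ‼ x ≡ ((x + c) % n <ᵇ ∣ Q ∣)) → ∃[ c ] (c < n × Q ≡ arc c)
      as-arc (c , c<n , Q≗) = c , c<n , ‼-ext {p = Q} {q = arc c} pointwise
        where
        pointwise : ∀ x → x < n → Q ‼ x ≡ arc c ‼ x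
        pointwise x x<n = trans (Q≗ x x<n) (trans (cong ((x + c) % n <ᵇ_) ∣Q∣≡h) (sym (‼-fromPred n (inArc c) x<n)))

    smaller-block : ∀ {a b} → a + b ≡ n → a ≤ b → b ≤ a + 1 → a ≡ h
    smaller-block {a} {b} a+b≡n a≤b b≤a+1 = half-unique
      (subst (_≤ n) (cong (a +_) (sym (+-identityʳ a))) (subst (a + a ≤_) a+b≡n (+-monoʳ-≤ a a≤b)))
      (subst (_≤ suc (2 * a)) a+b≡n (≤-trans (+-monoʳ-≤ a b≤a+1) (≤-reflexive (a+[a+1]≡1+2a a))))

    equitable⇒arc : ∀ P → EquitConnPartition n P → ∃[ c ] (c < n × (P ≡ arc c ⊎ ∁ P ≡ arc c))
    equitable⇒arc P ((∣P∣≤∣∁P∣+1 , ∣∁P∣≤∣P∣+1) , P-connected , ∁P-connected) =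
      [ (λ ∣P∣≤∣∁P∣ → map₂ (map₂ inj₁) (block-is-arc P P-connected
                        (smaller-block (∣p∣+∣∁p∣≡n P) ∣P∣≤∣∁P∣ ∣∁P∣≤∣P∣+1)))
      , (λ ∣∁P∣≤∣P∣ → map₂ (map₂ inj₂) (block-is-arc (∁ P) ∁P-connected
                        (smaller-block (trans (+-comm ∣ ∁ P ∣ ∣ P ∣) (∣p∣+∣∁p∣≡n P)) ∣∁P∣≤∣P∣ ∣P∣≤∣∁P∣+1)))
      ]′ (≤-total ∣ P ∣ ∣ ∁ P ∣)

    ∀equitable⇔∀arc : ∀ (Φ : Subset n → Set) →
                      (∀ P → EquitConnPartition n P → Φ P) ⇔ (∀ c → c < n → Φ (arc c) × Φ (∁ (arc c)))
    ∀equitable⇔∀arc Φ = mk⇔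
      (λ Φ-all c c<n → Φ-all (arc c) (arc-equitable c c<n) , Φ-all (∁ (arc c)) (∁arc-equitable c c<n))
      (λ Φ-arcs P P-equitable → from-arc P (equitable⇒arc P P-equitable) Φ-arcs)
      where
      from-arc : ∀ P → ∃[ c ] (c < n × (P ≡ arc c ⊎ ∁ P ≡ arc c)) →
                 (∀ c → c < n → Φ (arc c) × Φ (∁ (arc c))) → Φ P
      from-arc P (c , c<n , inj₁ refl)   Φ-arcs = proj₁ (Φ-arcs c c<n)
      from-arc P (c , c<n , inj₂ ∁P≡arc) Φ-arcs =
        subst Φ (trans (cong ∁ (sym ∁P≡arc)) (∁-involutive P)) (proj₂ (Φ-arcs c c<n))

    balanced⇔ : ∀ A → Balanced n A ⇔ (∀ c → c < n → DiffAtMost 1 (In A c) (Out A c))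
    balanced⇔ A = ⇔-trans (∀equitable⇔∀arc Φ) (mk⇔
      (λ Φ-arcs c c<n → proj₁ (Φ-arcs c c<n))
      (λ D c c<n → D c c<n , subst (λ Q → DiffAtMost 1 (Out A c) ∣ A ∩ Q ∣) (sym (∁-involutive (arc c)))
                                   (DiffAtMost-sym (D c c<n))))
      where
      Φ : Subset n → Set
      Φ P = DiffAtMost 1 ∣ A ∩ P ∣ ∣ A ∩ ∁ P ∣

    weaklyBalanced⇔ : ∀ A → WeaklyBalanced n A ⇔ (∀ c → c < n → WeakPair (In A c) (Out A c))
    weaklyBalanced⇔ A = ⇔-trans (∀equitable⇔∀arc Φ) (mk⇔
      (λ Φ-arcs c c<n → to (proj₁ (Φ-arcs c c<n)) (Φ∁arc c (proj₂ (Φ-arcs c c<n))))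
      (λ P c c<n → from (P c c<n)))
      where
      Φ : Subset n → Set
      Φ P = DiffAtMost 2 ∣ A ∩ P ∣ ∣ A ∩ ∁ P ∣ × (∣ A ∩ ∁ P ∣ ≡ ∣ A ∩ P ∣ + 2 → ∣ P ∣ < ∣ ∁ P ∣)
      Φ′ : ℕ → Subset n → Set
      Φ′ c Q = DiffAtMost 2 (Out A c) ∣ A ∩ Q ∣ × (∣ A ∩ Q ∣ ≡ Out A c + 2 → ∣ ∁ (arc c) ∣ < ∣ Q ∣)
      Φ∁arc : ∀ c → Φ (∁ (arc c)) → Φ′ c (arc c)
      Φ∁arc c = subst (Φ′ c) (∁-involutive (arc c))
      to : ∀ {c} → Φ (arc c) → Φ′ c (arc c) → WeakPair (In A c) (Out A c)
      to {c} (D , out-heavy) (_ , in-heavy) =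
        D ,
        (λ e → subst₂ _<_ (∣arc∣≡h c) (∣∁arc∣≡n∸h c) (out-heavy e)) ,
        (λ e → ≤⇒≯ h≤n∸h (subst₂ _<_ (∣∁arc∣≡n∸h c) (∣arc∣≡h c) (in-heavy e)))
      from : ∀ {c} → WeakPair (In A c) (Out A c) → Φ (arc c) × Φ (∁ (arc c))
      from {c} ((a≤b+2 , b≤a+2) , out-heavy , in-not-heavy) =
        ((a≤b+2 , b≤a+2) , λ e → subst₂ _<_ (sym (∣arc∣≡h c)) (sym (∣∁arc∣≡n∸h c)) (out-heavy e)) ,
        subst (Φ′ c) (sym (∁-involutive (arc c))) ((b≤a+2 , a≤b+2) , λ e → contradiction e in-not-heavy)

  -- Parity cases

  module _ (A : Subset n) (2≤∣A∣ : 2 ≤ ∣ A ∣) where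

    private
      m = ∣ A ∣

      m≤n : m ≤ n
      m≤n = ∣p∣≤n A

      0<h : 0 < h
      0<h = n≢0⇒n>0 (λ h≡0 → contradiction (≤-trans 2≤∣A∣ (≤-trans m≤n n≤1+2h))
                                           (subst (λ x → 2 ≰ suc (2 * x)) (sym h≡0) λ { (s≤s ()) }))

      C₀ : ℕ
      C₀ = h * m / n

      maximizer⇔near-at : ∀ {C} → C₀ ≡ C → Maximizer n A ⇔ (∀ c → c < n → Near C (In A c))
      maximizer⇔near-at refl = maximizer⇔near A (evenlySpaced m) C₀ (∣evenlySpaced∣≡ m≤n) (near-In-evenlySpaced m≤n)

      C₀-odd : ∀ {q} → m ≡ suc (2 * q) → C₀ ≡ q
      C₀-odd {q} m≡1+2q = q*n≤m<[1+q]*n⇒m/n≡q lower upper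
        where
        open ≤-Reasoning
        q≤h : q ≤ h
        q≤h = *-cancelˡ-≤ 2 (s≤s⁻¹ (subst (_≤ suc (2 * h)) m≡1+2q (≤-trans m≤n n≤1+2h)))
        expand₁ : ∀ q h → q * suc (2 * h) ≡ h * (2 * q) + q
        expand₁ = solve-∀
        expand₂ : ∀ h q → h * suc (2 * q) ≡ h * (2 * q) + h
        expand₂ = solve-∀
        expand₃ : ∀ h q → h * (2 * q) + (h + h) ≡ suc q * (2 * h)
        expand₃ = solve-∀
        lower : q * n ≤ h * m
        lower = begin
          q * n                 ≤⟨ *-monoʳ-≤ q n≤1+2h ⟩
          q * suc (2 * h)       ≡⟨ expand₁ q h ⟩
          h * (2 * q) + q       ≤⟨ +-monoʳ-≤ (h * (2 * q)) q≤h ⟩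
          h * (2 * q) + h       ≡⟨ sym (expand₂ h q) ⟩
          h * suc (2 * q)       ≡⟨ cong (h *_) (sym m≡1+2q) ⟩
          h * m                 ∎
        upper : h * m < suc q * n
        upper = begin-strict
          h * m                 ≡⟨ cong (h *_) m≡1+2q ⟩
          h * suc (2 * q)       ≡⟨ expand₂ h q ⟩
          h * (2 * q) + h       <⟨ +-monoʳ-< (h * (2 * q)) (m<m+n h 0<h) ⟩
          h * (2 * q) + (h + h) ≡⟨ expand₃ h q ⟩
          suc q * (2 * h)       ≤⟨ *-monoʳ-≤ (suc q) 2h≤n ⟩
          suc q * n             ∎

      C₀-even-even : ∀ {q} → n ≡ 2 * h → m ≡ 2 * q → C₀ ≡ q
      C₀-even-even {q} n≡2h m≡2q = trans (cong (_/ n) h*m≡q*n) (m*n/n≡m q n)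
        where
        regroup : ∀ h q → h * (2 * q) ≡ q * (2 * h)
        regroup = solve-∀
        h*m≡q*n : h * m ≡ q * n
        h*m≡q*n = trans (cong (h *_) m≡2q) (trans (regroup h q) (cong (q *_) (sym n≡2h)))

      C₀-odd-even : ∀ {p} → n ≡ suc (2 * h) → m ≡ 2 * suc p → C₀ ≡ p
      C₀-odd-even {p} n≡1+2h m≡2[1+p] = q*n≤m<[1+q]*n⇒m/n≡q lower upper
        where
        open ≤-Reasoning
        p≤2h : p ≤ 2 * h
        p≤2h = s≤s⁻¹ (subst (p <_) n≡1+2h (<-≤-trans p<m m≤n))
          where
          p<2[1+p] : ∀ p → p < 2 * suc p
          p<2[1+p] p = <-≤-trans (n<1+n p) (m≤m+n (suc p) (suc p + 0))
          p<m : p < m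
          p<m = subst (p <_) (sym m≡2[1+p]) (p<2[1+p] p)
        expand₁ : ∀ p h → p * suc (2 * h) ≡ h * (2 * p) + p
        expand₁ = solve-∀
        expand₂ : ∀ h p → h * (2 * p) + 2 * h ≡ h * (2 * suc p)
        expand₂ = solve-∀
        expand₃ : ∀ h p → suc p * suc (2 * h) ≡ h * (2 * suc p) + suc p
        expand₃ = solve-∀
        lower : p * n ≤ h * m
        lower = begin
          p * n                 ≡⟨ cong (p *_) n≡1+2h ⟩
          p * suc (2 * h)       ≡⟨ expand₁ p h ⟩
          h * (2 * p) + p       ≤⟨ +-monoʳ-≤ (h * (2 * p)) p≤2h ⟩
          h * (2 * p) + 2 * h   ≡⟨ expand₂ h p ⟩
          h * (2 * suc p)       ≡⟨ cong (h *_) (sym m≡2[1+p]) ⟩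
          h * m                 ∎
        upper : h * m < suc p * n
        upper = begin-strict
          h * m                     ≡⟨ cong (h *_) m≡2[1+p] ⟩
          h * (2 * suc p)           <⟨ m<m+n _ z<s ⟩
          h * (2 * suc p) + suc p   ≡⟨ sym (expand₃ h p) ⟩
          suc p * suc (2 * h)       ≡⟨ cong (suc p *_) (sym n≡1+2h) ⟩
          suc p * n                 ∎

      even⇒≡2[1+p] : 2 ∣ m → ∃[ p ] m ≡ 2 * suc p
      even⇒≡2[1+p] 2∣m = positive-half (m / 2) (even⇒≡2*half 2∣m)
        where
        positive-half : ∀ q → m ≡ 2 * q → ∃[ p ] m ≡ 2 * suc p
        positive-half zero    m≡0      = contradiction (subst (2 ≤_) m≡0 2≤∣A∣) λ ()
        positive-half (suc p) m≡2[1+p] = p , m≡2[1+p]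

      -- With n and m even the average arc count h m / n is the integer m / 2, so no arc can exceed it.
      near⇒≡-even-even : ∀ {q} → n ≡ 2 * h → m ≡ 2 * q →
                         (∀ c → c < n → Near q (In A c)) → ∀ c → c < n → In A c ≡ q
      near⇒≡-even-even {q} n≡2h m≡2q near c c<n =
        sym (∑-mono-≤-tight n (λ c c<n → near⇒≥ (near c c<n)) ∑q≡∑In c c<n)
        where
        regroup : ∀ h q → 2 * h * q ≡ h * (2 * q)
        regroup = solve-∀
        ∑q≡∑In : ∑[ c < n ] q ≡ ∑[ c < n ] In A c
        ∑q≡∑In = trans (∑-const n q) (trans (cong (_* q) n≡2h)
                   (trans (regroup h q) (trans (cong (h *_) (sym m≡2q)) (sym (∑In≡h*∣A∣ A)))))

    maximizer⇔balanced : 2 ∣ n ⊎ ¬ (2 ∣ m) → Maximizer n A ⇔ Balanced n A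
    maximizer⇔balanced parity = ⇔-trans (max⇔diff≤1 (2 ∣? m) parity) (⇔-sym (balanced⇔ 0<h A))
      where
      max⇔diff≤1 : Dec (2 ∣ m) → 2 ∣ n ⊎ ¬ (2 ∣ m) →
                   Maximizer n A ⇔ (∀ c → c < n → DiffAtMost 1 (In A c) (Out A c))
      max⇔diff≤1 (no 2∤m) _ =
        ⇔-trans (maximizer⇔near-at (C₀-odd {q = m / 2} m≡1+2q))
                (∀<-⇔ (λ c → ⇔-sym (diff≤1⇔near-half {q = m / 2} (trans (In+Out≡∣A∣ A c) m≡1+2q))))
        where
        m≡1+2q : m ≡ suc (2 * (m / 2))
        m≡1+2q = odd⇒≡1+2*half 2∤m
      max⇔diff≤1 (yes 2∣m) (inj₂ 2∤m) = contradiction 2∣m 2∤m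
      max⇔diff≤1 (yes 2∣m) (inj₁ 2∣n) = ⇔-trans (maximizer⇔near-at (C₀-even-even {q = m / 2} n≡2h m≡2q)) (mk⇔
        (λ near c c<n → Equivalence.from (diff≤1⇔≡half {q = m / 2} (In+Out≡2q c))
                          (near⇒≡-even-even {q = m / 2} n≡2h m≡2q near c c<n))
        (λ diff≤1 c c<n → inj₁ (Equivalence.to (diff≤1⇔≡half {q = m / 2} (In+Out≡2q c)) (diff≤1 c c<n))))
        where
        n≡2h : n ≡ 2 * h
        n≡2h = even⇒≡2*half 2∣n
        m≡2q : m ≡ 2 * (m / 2)
        m≡2q = even⇒≡2*half 2∣m
        In+Out≡2q : ∀ c → In A c + Out A c ≡ 2 * (m / 2)
        In+Out≡2q c = trans (In+Out≡∣A∣ A c) m≡2q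

    balanced⇔weaklyBalanced : 2 ∣ n ⊎ ¬ (2 ∣ m) → Balanced n A ⇔ WeaklyBalanced n A
    balanced⇔weaklyBalanced parity =
      ⇔-trans (balanced⇔ 0<h A) (⇔-trans (∀<-⇔ diff≤1⇔weakPair) (⇔-sym (weaklyBalanced⇔ 0<h A)))
      where
      out≢in+2 : 2 ∣ n ⊎ ¬ (2 ∣ m) → ∀ c → Out A c ≡ In A c + 2 → h < n ∸ h → ⊥
      out≢in+2 (inj₁ 2∣n) c out≡in+2 = <-irrefl (sym n∸h≡h)
        where
        n∸h≡h : n ∸ h ≡ h
        n∸h≡h = trans (cong (_∸ h) (even⇒≡2*half 2∣n)) (trans (m+n∸m≡n h (h + 0)) (+-identityʳ h))
      out≢in+2 (inj₂ 2∤m) c out≡in+2 _ =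
        odd-sum⇒≢+2 {q = m / 2} (trans (+-comm (Out A c) (In A c)) (trans (In+Out≡∣A∣ A c) (odd⇒≡1+2*half 2∤m)))
                    out≡in+2
      diff≤1⇔weakPair : ∀ c → DiffAtMost 1 (In A c) (Out A c) ⇔ WeakPair (In A c) (Out A c)
      diff≤1⇔weakPair c = mk⇔
        (λ diff≤1 → diff≤1⇒diff≤2 diff≤1 ,
                    (λ out≡in+2 → contradiction out≡in+2 (diff≤1⇒≢+2 (DiffAtMost-sym diff≤1))) ,
                    diff≤1⇒≢+2 diff≤1)
        (λ (diff≤2 , out-heavy , in≢out+2) →
           diff≤2⇒diff≤1 diff≤2 in≢out+2 (λ e → out≢in+2 parity c e (out-heavy e)))

    maximizer⇔weaklyBalanced-odd-even : ¬ (2 ∣ n) → 2 ∣ m → Maximizer n A ⇔ WeaklyBalanced n A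
    maximizer⇔weaklyBalanced-odd-even 2∤n 2∣m = max⇔weakPair (even⇒≡2[1+p] 2∣m)
      where
      n≡1+2h : n ≡ suc (2 * h)
      n≡1+2h = odd⇒≡1+2*half 2∤n
      h<n∸h : h < n ∸ h
      h<n∸h = m+n≤o⇒m≤o∸n (suc h) (subst (suc (h + h) ≤_) (sym n≡1+2h) (s≤s (+-monoʳ-≤ h (m≤m+n h 0))))
      max⇔weakPair : ∃[ p ] m ≡ 2 * suc p → Maximizer n A ⇔ WeaklyBalanced n A
      max⇔weakPair (p , m≡2[1+p]) =
        ⇔-trans (maximizer⇔near-at (C₀-odd-even n≡1+2h m≡2[1+p]))
                (⇔-trans (∀<-⇔ near⇔weakPair) (⇔-sym (weaklyBalanced⇔ 0<h A)))
        where
        near⇔weakPair : ∀ c → Near p (In A c) ⇔ WeakPair (In A c) (Out A c)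
        near⇔weakPair c = mk⇔
          (λ near → let (diff≤2 , in≢out+2) = Equivalence.from pair⇔near near in diff≤2 , (λ _ → h<n∸h) , in≢out+2)
          (λ (diff≤2 , _ , in≢out+2) → Equivalence.to pair⇔near (diff≤2 , in≢out+2))
          where
          pair⇔near = diff≤2⇔near-pred-half (trans (In+Out≡∣A∣ A c) m≡2[1+p])

    -- With n odd the arcs would all have to hold exactly m / 2 elements, but n (m / 2) ≠ h m.
    ¬balanced-odd-even : ¬ (2 ∣ n) → 2 ∣ m → ¬ Balanced n A
    ¬balanced-odd-even 2∤n 2∣m A-balanced = no-even-split (even⇒≡2[1+p] 2∣m)
      where
      no-even-split : ∃[ p ] m ≡ 2 * suc p → ⊥
      no-even-split (p , m≡2[1+p]) = m+1+n≢m (h * m) (begin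
        h * m + suc p             ≡⟨ cong (λ x → h * x + suc p) m≡2[1+p] ⟩
        h * (2 * suc p) + suc p   ≡⟨ expand h p ⟩
        suc (2 * h) * suc p       ≡⟨ cong (_* suc p) (sym (odd⇒≡1+2*half 2∤n)) ⟩
        n * suc p                 ≡⟨ sym (∑-const n (suc p)) ⟩
        ∑[ c < n ] suc p          ≡⟨ sym (∑-cong n In≡1+p) ⟩
        ∑[ c < n ] In A c         ≡⟨ ∑In≡h*∣A∣ A ⟩
        h * m                     ∎)
        where
        open ≡-Reasoning
        expand : ∀ h p → h * (2 * suc p) + suc p ≡ suc (2 * h) * suc p
        expand = solve-∀
        In≡1+p : ∀ c → c < n → In A c ≡ suc p
        In≡1+p c c<n = Equivalence.to (diff≤1⇔≡half (trans (In+Out≡∣A∣ A c) m≡2[1+p]))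
                                      (Equivalence.to (balanced⇔ 0<h A) A-balanced c c<n)

    maximizer⇔weaklyBalanced : Maximizer n A ⇔ WeaklyBalanced n A
    maximizer⇔weaklyBalanced = by-parity (2 ∣? n) (2 ∣? m)
      where
      via-balanced : 2 ∣ n ⊎ ¬ (2 ∣ m) → Maximizer n A ⇔ WeaklyBalanced n A
      via-balanced parity = ⇔-trans (maximizer⇔balanced parity) (balanced⇔weaklyBalanced parity)
      by-parity : Dec (2 ∣ n) → Dec (2 ∣ m) → Maximizer n A ⇔ WeaklyBalanced n A
      by-parity (yes 2∣n) _         = via-balanced (inj₁ 2∣n)
      by-parity (no 2∤n)  (yes 2∣m) = maximizer⇔weaklyBalanced-odd-even 2∤n 2∣m
      by-parity (no _)    (no 2∤m)  = via-balanced (inj₂ 2∤m)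

theorem4p8 : (n : ℕ) (A : Subset n) → 2 ≤ ∣ A ∣ →
    ((2 ∣ n ⊎ ¬ (2 ∣ ∣ A ∣)) → (Maximizer n A ⇔ Balanced n A))
    × ((¬ (2 ∣ n) × 2 ∣ ∣ A ∣) →
        (Maximizer n A ⇔ WeaklyBalanced n A)
        × ((B : Subset n) → ∣ B ∣ ≡ ∣ A ∣ → Maximizer n B → ¬ Balanced n B))
    × (Maximizer n A ⇔ WeaklyBalanced n A)
theorem4p8 zero    A 2≤∣A∣ = contradiction (≤-trans 2≤∣A∣ (∣p∣≤n A)) λ ()
theorem4p8 (suc k) A 2≤∣A∣ =
  maximizer⇔balanced A 2≤∣A∣ ,
  (λ (2∤n , 2∣∣A∣) →
     maximizer⇔weaklyBalanced-odd-even A 2≤∣A∣ 2∤n 2∣∣A∣ ,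
     -- for n odd no set of even size is balanced, maximizer or not
     λ B ∣B∣≡∣A∣ _ →
       ¬balanced-odd-even B (subst (2 ≤_) (sym ∣B∣≡∣A∣) 2≤∣A∣) 2∤n (subst (2 ∣_) (sym ∣B∣≡∣A∣) 2∣∣A∣)) ,
  maximizer⇔weaklyBalanced A 2≤∣A∣
  where open Cycle k
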